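{- If $\pi$ is a sorted permutation, then $\mathrm{swu}(\pi)$ and $\mathrm{swd}(\pi)$ are sorted. If, in addition, $\pi$ avoids $132$, then $\mathrm{swl}(\pi)$ is sorted.
   Context: Permutations are finite words of distinct positive integers; $S_n$ is the set of permutations of $[n]$; operators on arbitrary permutations are defined by normalizing (replacing the $i$-th smallest entry by $i$), applying the operator, and un-normalizing. The stack-sorting map $s$: $s(\text{empty})=\text{empty}$, and if $\pi=LnR$ with $n$ the largest entry, $s(\pi)=s(L)s(R)n$; $\pi$ is sorted if some permutation $\sigma$ satisfies $s(\sigma)=\pi$. A permutation avoids $\tau$ if no subsequence has the same relative order as $\tau$. $\mathrm{rev}$ reverses a word, $\pi^{ -1}$ is the group inverse, $\mathrm{rot}(\pi)=\mathrm{rev}(\pi^{ -1})$, and $\mathrm{rot}^{ -1}$ is its inverse. Sliding operators: for $\pi\in S_n$, $i\in[n]$, let $L_i$ (resp. $R_i$) be the set of elements of $[i-1]$ to the left (resp. right) of the entry $i$ in $\pi$. $\mathrm{swu}_i(\pi)$ has $j$-th entry $\pi_j$ if $\pi_j\ge i$, $m$ if $\pi_j$ is the $m$-th smallest element of $R_i$, and $i-m$ if $\pi_j$ is the $m$-th largest element of $L_i$. Let $\mathrm{swd}_i=\mathrm{rev}\circ\mathrm{swu}_i\circ\mathrm{rev}$, $\mathrm{swl}_i=\mathrm{rot}^{ -1}\circ\mathrm{swu}_i\circ\mathrm{rot}$, and on $S_n$ set $\mathrm{swu}=\mathrm{swu}_1\circ\cdots\circ\mathrm{swu}_n$, $\mathrm{swd}=\mathrm{swd}_1\circ\cdots\circ\mathrm{swd}_n$,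 $\mathrm{swl}=\mathrm{swl}_1\circ\cdots\circ\mathrm{swl}_n$. -}

module Defs where

open import Data.Nat using (ℕ; zero; suc; _+_; _∸_; _<_; _≤_; _⊔_; _<?_; _≤?_; _≟_)
open import Data.List using (List; []; _∷_; _++_; map; filter; length; reverse; foldr; upTo; break)
open import Data.List.Relation.Binary.Permutation.Propositional using (_↭_)
open import Data.List.Relation.Binary.Sublist.Propositional using (_⊆_)
open import Data.List.Relation.Unary.All using (All)
open import Data.List.Relation.Unary.Unique.Propositional using (Unique)
open import Data.Product using (Σ; _×_; _,_; ∃)
open import Data.Bool using (if_then_else_)
open import Relation.Nullary using (¬_; does)
open import Relation.Binary.PropositionalEquality using (_≡_)

range : ℕ → List ℕ
range n = map suc (upTo n)

IsPermOf : ℕ → List ℕ → Set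
IsPermOf n π = π ↭ range n

IsPermutation : List ℕ → Set
IsPermutation π = Unique π × All (λ x → 0 < x) π

maxL : List ℕ → ℕ
maxL = foldr _⊔_ 0

-- s with fuel (fuel = length suffices, since L and R are shorter)
sFuel : ℕ → List ℕ → List ℕ
sFuel zero    π  = π
sFuel (suc k) [] = []
sFuel (suc k) (x ∷ xs) with break (maxL (x ∷ xs) ≟_) (x ∷ xs)
... | (L , [])    = x ∷ xs   -- impossible: the maximum occurs in the list
... | (L , m ∷ R) = sFuel k L ++ sFuel k R ++ m ∷ []

stackSort : List ℕ → List ℕ
stackSort π = sFuel (length π) π

Sorted : List ℕ → Set
Sorted π = Σ (List ℕ) λ σ → IsPermutation σ × stackSort σ ≡ π

count< : ℕ → List ℕ → ℕ
count< x xs = length (filter (_<? x) xs)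

std : List ℕ → List ℕ
std xs = map (λ x → suc (count< x xs)) xs

Contains : List ℕ → List ℕ → Set
Contains π τ = Σ (List ℕ) λ σ → (σ ⊆ π) × std σ ≡ τ

Avoids : List ℕ → List ℕ → Set
Avoids π τ = ¬ Contains π τ

-- 1-based position of v in π
position : ℕ → List ℕ → ℕ
position v [] = 0
position v (x ∷ xs) = if does (v ≟ x) then 1 else suc (position v xs)

inverse : ℕ → List ℕ → List ℕ
inverse n π = map (λ v → position v π) (range n)

rot : ℕ → List ℕ → List ℕ
rot n π = reverse (inverse n π)

rot⁻¹ : ℕ → List ℕ → List ℕ
rot⁻¹ n σ = inverse n (reverse σ)

count> : ℕ → List ℕ → ℕ
count> x xs = length (filter (x <?_) xs)

swuᵢ : ℕ → List ℕ → List ℕ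
swuᵢ i π with break (i ≟_) π
... | (A , [])    = π   -- i does not occur (impossible on S_n with i ∈ [n])
... | (A , j ∷ B) = map g A ++ j ∷ map h B
  where
    Lᵢ = filter (_<? i) A
    Rᵢ = filter (_<? i) B
    -- x is the m-th largest element of Lᵢ with m = 1 + #{y ∈ Lᵢ | y > x}
    g : ℕ → ℕ
    g x = if does (x <? i) then i ∸ suc (count> x Lᵢ) else x
    -- x is the m-th smallest element of Rᵢ with m = 1 + #{y ∈ Rᵢ | y < x}
    h : ℕ → ℕ
    h x = if does (x <? i) then suc (count< x Rᵢ) else x

swdᵢ : ℕ → List ℕ → List ℕ
swdᵢ i π = reverse (swuᵢ i (reverse π))

swlᵢ : ℕ → ℕ → List ℕ → List ℕ
swlᵢ n i π = rot⁻¹ n (swuᵢ i (rot n π))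

-- f₁ ∘ f₂ ∘ ⋯ ∘ fₙ  (so fₙ is applied first)
composeDown : ℕ → (ℕ → List ℕ → List ℕ) → List ℕ → List ℕ
composeDown n f π = foldr f π (range n)

swu : ℕ → List ℕ → List ℕ
swu n = composeDown n swuᵢ

swd : ℕ → List ℕ → List ℕ
swd n = composeDown n swdᵢ

swl : ℕ → List ℕ → List ℕ
swl n = composeDown n (swlᵢ n)

p132 : List ℕ
p132 = 1 ∷ 3 ∷ 2 ∷ []

-- A permutation is sorted iff it is the postorder reading of a decreasing binary tree, since
-- s(LnR) = s(L)s(R)n. The operator swuᵢ only relabels the entries below i, order-preservingly on
-- each side of i, sending those left of i above those right of i. Every subtree occupies a segment
-- of the word, which lies left of i, right of i, or contains i (and then has a root ≥ i), so each
-- node stays below its root; swdᵢ is the mirror image.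
-- Conjugated by rot, swlᵢ becomes a pivoting step: the entries before position i are stably split
-- into those below and those above the i-th entry. Hence W = swl satisfies
-- W(τy) = W(τ₍<y₎) W(τ₍>y₎) y, and if τy avoids 132 then τ = τ₍>y₎ τ₍<y₎. By induction over words
-- that concatenate at most k trees, W never increases the number of trees: the two trees below y
-- in τy are the last two trees of τ₍<y₎, and in W(τy) the last two trees of W(τ₍<y₎) can be grafted
-- below the leftmost leaf of the first tree of W(τ₍>y₎), while y becomes a tree of its own.
module Submission where

open import Defs
open import Data.Bool using (true; false; if_then_else_)
open import Data.Empty using (⊥-elim)
open import Data.List
  using (List; []; _∷_; _++_; [_]; map; filter; length; reverse; foldr; upTo; applyUpTo; break; take; drop;
         initLast; _∷ʳ′_)
open import Data.List.Properties
open import Data.List.Membership.Propositional using (_∈_; _∉_)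
open import Data.List.Membership.Propositional.Properties
  using (∈-++⁺ˡ; ∈-++⁺ʳ; ∈-++⁻; ∈-filter⁺; ∈-filter⁻; ∈-map⁻; ∈-upTo⁻)
open import Data.List.Relation.Unary.All as All using (All; []; _∷_)
import Data.List.Relation.Unary.All.Properties as Allₚ
open import Data.List.Relation.Unary.AllPairs as AllPairs using (AllPairs; []; _∷_)
open import Data.List.Relation.Unary.Any as Any using (here; there)
open import Data.List.Relation.Unary.Unique.Propositional using (Unique)
import Data.List.Relation.Unary.Unique.Propositional.Properties as Uₚ
open import Data.List.Relation.Binary.Permutation.Propositional
  using (_↭_; ↭-refl; ↭-sym; ↭-trans; ↭-reflexive; prep; ↭⇒↭ₛ)
import Data.List.Relation.Binary.Permutation.Propositional.Properties as PermProps
open PermProps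
  using (All-resp-↭; ∈-resp-↭; ↭-length; ++⁺ˡ; ++⁺ʳ; ∷↭∷ʳ; ↭-reverse) renaming (shift to ↭-shift)
import Data.List.Relation.Binary.Permutation.Setoid.Properties as Permₛ
open import Data.List.Relation.Binary.Sublist.Propositional
  using (_⊆_; []; _∷_; _∷ʳ_; ⊆-refl; ⊆-trans; from∈) renaming (lookup to ⊆-lookup)
import Data.List.Relation.Binary.Sublist.Propositional.Properties as Sub
open Sub using (All-resp-⊆)
open import Data.Nat using (ℕ; zero; suc; _+_; _∸_; _<_; _≤_; _>_; _<?_; _≤?_; _≟_; z≤n; s≤s)
open import Data.Nat.Properties
open import Data.List.Membership.DecPropositional _≟_ using (_∈?_)
open import Data.Nat.Tactic.RingSolver using (solve-∀)
open import Data.Product using (∃-syntax; _×_; _,_; proj₁; proj₂)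
open import Data.Sum using (_⊎_; inj₁; inj₂)
open import Function using (_∘_)
open import Relation.Binary.Definitions using (tri<; tri≈; tri>)
open import Relation.Binary.PropositionalEquality
  using (_≡_; _≢_; refl; sym; trans; cong; cong₂; subst; subst₂; setoid; module ≡-Reasoning)
open import Relation.Nullary using (¬_; Dec; yes; no; does)
open import Relation.Nullary.Decidable using (decidable-stable)
open import Relation.Unary using (Decidable; ∁)
open import Relation.Unary.Properties using (∁?)

Unique-resp-↭ : ∀ {xs ys : List ℕ} → xs ↭ ys → Unique xs → Unique ys
Unique-resp-↭ = Permₛ.Unique-resp-↭ (setoid ℕ) ∘ ↭⇒↭ₛ

Unique-resp-⊆ : ∀ {xs ys : List ℕ} → xs ⊆ ys → Unique ys → Unique xs
Unique-resp-⊆ []         _         = []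
Unique-resp-⊆ (_ ∷ʳ s)   (_ ∷ u)   = Unique-resp-⊆ s u
Unique-resp-⊆ (refl ∷ s) (x∉ ∷ u) = All-resp-⊆ s x∉ ∷ Unique-resp-⊆ s u

Unique-++⁻-disjoint : ∀ xs {ys : List ℕ} {z} → Unique (xs ++ ys) → z ∈ xs → z ∉ ys
Unique-++⁻-disjoint (x ∷ xs) (x∉ ∷ _) (here refl) z∈ = All.lookup x∉ (∈-++⁺ʳ xs z∈) refl
Unique-++⁻-disjoint (x ∷ xs) (_ ∷ u)  (there z∈xs) = Unique-++⁻-disjoint xs u z∈xs

Unique-∷-middle : ∀ xs {m : ℕ} {ys} → Unique (xs ++ m ∷ ys) → m ∉ xs × m ∉ ys
Unique-∷-middle xs u =
  (λ m∈xs → Unique-++⁻-disjoint xs u m∈xs (here refl)) ,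
  (λ m∈ys → Unique-++⁻-disjoint (xs ++ [ _ ]) (subst Unique (sym (∷ʳ-++ xs _ _)) u)
              (∈-++⁺ʳ xs (here refl)) m∈ys)

Unique-map⁺ : ∀ (F : ℕ → ℕ) {xs} → (∀ {x y} → x ∈ xs → y ∈ xs → F x ≡ F y → x ≡ y) →
  Unique xs → Unique (map F xs)
Unique-map⁺ F {[]}     _   []        = []
Unique-map⁺ F {x ∷ xs} inj (x∉ ∷ u) =
  Allₚ.map⁺ (All.tabulate (λ y∈ Fx≡Fy → All.lookup x∉ y∈ (inj (here refl) (there y∈) Fx≡Fy))) ∷
  Unique-map⁺ F (λ x∈ y∈ → inj (there x∈) (there y∈)) u

++-≡-++ : ∀ (X : List ℕ) {Y P Q} → X ++ Y ≡ P ++ Q →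
  (∃[ w ] X ≡ P ++ w × Q ≡ w ++ Y) ⊎ (∃[ w ] P ≡ X ++ w × Y ≡ w ++ Q)
++-≡-++ []      {P = P}     e    = inj₂ (P , refl , e)
++-≡-++ (x ∷ X) {P = []}    e    = inj₁ (x ∷ X , refl , sym e)
++-≡-++ (x ∷ X) {P = _ ∷ _} e with refl , e′ ← ∷-injective e with ++-≡-++ X e′
... | inj₁ (w , X≡ , Q≡) = inj₁ (w , cong (x ∷_) X≡ , Q≡)
... | inj₂ (w , P≡ , Y≡) = inj₂ (w , cong (x ∷_) P≡ , Y≡)

++-≡-++-∷ : ∀ (X : List ℕ) {Z pre i post} → X ++ Z ≡ pre ++ i ∷ post →
  (∃[ w ] X ≡ pre ++ i ∷ w × post ≡ w ++ Z) ⊎ (∃[ w ] pre ≡ X ++ w × Z ≡ w ++ i ∷ post)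
++-≡-++-∷ X {Z} {pre} e with ++-≡-++ X e
... | inj₂ split               = inj₂ split
... | inj₁ (_ ∷ w , X≡ , refl) = inj₁ (w , X≡ , refl)
... | inj₁ ([] , X≡ , i∷post≡) =
  inj₂ ([] , trans (sym (++-identityʳ pre)) (trans (sym X≡) (sym (++-identityʳ X))) , sym i∷post≡)

length-++-∷-≤ : ∀ xs (y : ℕ) ys {k} → length (xs ++ y ∷ ys) ≤ suc k → length xs ≤ k × length ys ≤ k
length-++-∷-≤ xs y ys {k} len = ≤-trans (m≤m+n _ _) len′ , ≤-trans (m≤n+m _ _) len′
  where
  len′ : length xs + length ys ≤ k
  len′ = ≤-pred (subst (_≤ suc k) (trans (length-++ xs) (+-suc (length xs) (length ys))) len)

reverse-around : ∀ X (i : ℕ) Y → reverse (X ++ i ∷ Y) ≡ reverse Y ++ i ∷ reverse X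
reverse-around X i Y = begin
  reverse (X ++ i ∷ Y)            ≡⟨ reverse-++ X (i ∷ Y) ⟩
  reverse (i ∷ Y) ++ reverse X    ≡⟨ cong (_++ reverse X) (unfold-reverse i Y) ⟩
  (reverse Y ++ [ i ]) ++ reverse X ≡⟨ ++-assoc (reverse Y) [ i ] (reverse X) ⟩
  reverse Y ++ i ∷ reverse X      ∎
  where open ≡-Reasoning

∈-reverse⁻ : ∀ {x : ℕ} xs → x ∈ reverse xs → x ∈ xs
∈-reverse⁻ xs = ∈-resp-↭ (↭-reverse xs)

if-does-yes : ∀ {P : Set} (P? : Dec P) {a b : ℕ} → P → (if does P? then a else b) ≡ a
if-does-yes (yes _) _ = refl
if-does-yes (no ¬p) p = ⊥-elim (¬p p)

if-does-no : ∀ {P : Set} (P? : Dec P) {a b : ℕ} → ¬ P → (if does P? then a else b) ≡ b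
if-does-no (yes p) ¬p = ⊥-elim (¬p p)
if-does-no (no _)  _  = refl

module _ {P : ℕ → Set} (P? : Decidable P) where

  filter-++-filter-∁-↭ : ∀ xs → filter P? xs ++ filter (∁? P?) xs ↭ xs
  filter-++-filter-∁-↭ []       = ↭-refl
  filter-++-filter-∁-↭ (x ∷ xs) with P? x
  ... | yes _ = prep x (filter-++-filter-∁-↭ xs)
  ... | no  _ = ↭-trans (↭-shift x (filter P? xs) _) (prep x (filter-++-filter-∁-↭ xs))

module _ {P Q : ℕ → Set} (P? : Decidable P) (Q? : Decidable Q) (P⇒Q : ∀ {x} → P x → Q x) where

  length-filter-mono : ∀ xs → length (filter P? xs) ≤ length (filter Q? xs)
  length-filter-mono xs = Sub.length-mono-≤ (Sub.filter⁺ P? Q? (λ { refl → P⇒Q }) (⊆-refl {x = xs}))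

  length-filter-< : ∀ xs {w} → w ∈ xs → Q w → ¬ P w → length (filter P? xs) < length (filter Q? xs)
  length-filter-< (x ∷ xs) w∈ qw ¬pw with P? x | Q? x | w∈
  ... | yes px | no ¬qx | _          = ⊥-elim (¬qx (P⇒Q px))
  ... | yes px | yes _  | here refl  = ⊥-elim (¬pw px)
  ... | yes _  | yes _  | there w∈xs = s≤s (length-filter-< xs w∈xs qw ¬pw)
  ... | no _   | yes _  | here refl  = s≤s (length-filter-mono xs)
  ... | no _   | yes _  | there w∈xs = m≤n⇒m≤1+n (length-filter-< xs w∈xs qw ¬pw)
  ... | no _   | no ¬qx | here refl  = ⊥-elim (¬qx qw)
  ... | no _   | no _   | there w∈xs = length-filter-< xs w∈xs qw ¬pw

length-filter-∈ : ∀ {P : ℕ → Set} (P? : Decidable P) xs {x} → x ∈ xs → ¬ P x →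
  length (filter P? xs) < length xs
length-filter-∈ P? xs x∈ ¬px = filter-notAll P? xs (Any.map (λ { refl → ¬px }) x∈)

Unique-constant-length : ∀ {c : ℕ} {xs} → Unique xs → All (_≡ c) xs → length xs ≤ 1
Unique-constant-length []                   _                 = z≤n
Unique-constant-length (_ ∷ [])             _                 = s≤s z≤n
Unique-constant-length ((x≢y ∷ _) ∷ _ ∷ _) (refl ∷ refl ∷ _) = ⊥-elim (x≢y refl)

Unique-below-length : ∀ k xs → Unique xs → All (_< k) xs → length xs ≤ k
Unique-below-length zero    []      _ _        = z≤n
Unique-below-length zero    (_ ∷ _) _ (() ∷ _)
Unique-below-length (suc k) xs      u xs<1+k   = begin
  length xs
    ≡⟨ ↭-length (↭-sym (filter-++-filter-∁-↭ (_<? k) xs)) ⟩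
  length (filter (_<? k) xs ++ filter (∁? (_<? k)) xs)
    ≡⟨ length-++ (filter (_<? k) xs) ⟩
  length (filter (_<? k) xs) + length (filter (∁? (_<? k)) xs)
    ≤⟨ +-mono-≤ (Unique-below-length k _ (Uₚ.filter⁺ (_<? k) u) (Allₚ.all-filter (_<? k) xs))
                (Unique-constant-length (Uₚ.filter⁺ (∁? (_<? k)) u) equal-k) ⟩
  k + 1
    ≡⟨ +-comm k 1 ⟩
  suc k ∎
  where
  open ≤-Reasoning
  equal-k : All (_≡ k) (filter (∁? (_<? k)) xs)
  equal-k = All.tabulate λ z∈ → let z∈xs , z≮k = ∈-filter⁻ (∁? (_<? k)) z∈ in
    ≤-antisym (≤-pred (All.lookup xs<1+k z∈xs)) (≮⇒≥ z≮k)

module _ {P : ℕ → Set} (P? : Decidable P) where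

  filter-map : ∀ (f : ℕ → ℕ) xs → filter P? (map f xs) ≡ map f (filter (P? ∘ f) xs)
  filter-map f []       = refl
  filter-map f (x ∷ xs) with does (P? (f x))
  ... | true  = cong (f x ∷_) (filter-map f xs)
  ... | false = filter-map f xs

module _ {P Q : ℕ → Set} (P? : Decidable P) (Q? : Decidable Q) where

  filter-comm : ∀ xs → filter P? (filter Q? xs) ≡ filter Q? (filter P? xs)
  filter-comm []       = refl
  filter-comm (x ∷ xs) with P? x | Q? x
  ... | yes px | yes qx rewrite filter-accept P? {x} {filter Q? xs} px | filter-accept Q? {x} {filter P? xs} qx =
    cong (x ∷_) (filter-comm xs)
  ... | yes _  | no ¬qx rewrite filter-reject Q? {x} {filter P? xs} ¬qx = filter-comm xs
  ... | no ¬px | yes _  rewrite filter-reject P? {x} {filter Q? xs} ¬px = filter-comm xs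
  ... | no _   | no _   = filter-comm xs

  filter-cong-local : ∀ {xs} → All (λ x → (P x → Q x) × (Q x → P x)) xs → filter P? xs ≡ filter Q? xs
  filter-cong-local {[]}     []                = refl
  filter-cong-local {x ∷ xs} ((P⇒Q , Q⇒P) ∷ h) with P? x | Q? x
  ... | yes px | yes _  = cong (x ∷_) (filter-cong-local h)
  ... | yes px | no ¬qx = ⊥-elim (¬qx (P⇒Q px))
  ... | no ¬px | yes qx = ⊥-elim (¬px (Q⇒P qx))
  ... | no _   | no _   = filter-cong-local h

range-suc : ∀ m → range (suc m) ≡ range m ++ [ suc m ]
range-suc m = trans (cong (map suc) (sym (upTo-∷ʳ m))) (map-++ suc (upTo m) [ m ])

range-+ : ∀ a b → range (a + b) ≡ range a ++ map (a +_) (range b)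
range-+ a zero rewrite +-identityʳ a = sym (++-identityʳ (range a))
range-+ a (suc b) = begin
  range (a + suc b)
    ≡⟨ cong range (+-suc a b) ⟩
  range (suc (a + b))
    ≡⟨ range-suc (a + b) ⟩
  range (a + b) ++ [ suc (a + b) ]
    ≡⟨ cong (_++ [ suc (a + b) ]) (range-+ a b) ⟩
  (range a ++ map (a +_) (range b)) ++ [ suc (a + b) ]
    ≡⟨ ++-assoc (range a) _ _ ⟩
  range a ++ map (a +_) (range b) ++ [ suc (a + b) ]
    ≡⟨ cong (λ j → range a ++ map (a +_) (range b) ++ [ j ]) (sym (+-suc a b)) ⟩
  range a ++ map (a +_) (range b) ++ map (a +_) [ suc b ]
    ≡⟨ cong (range a ++_) (sym (map-++ (a +_) (range b) [ suc b ])) ⟩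
  range a ++ map (a +_) (range b ++ [ suc b ])
    ≡⟨ cong (λ js → range a ++ map (a +_) js) (sym (range-suc b)) ⟩
  range a ++ map (a +_) (range (suc b)) ∎
  where open ≡-Reasoning

length-range : ∀ n → length (range n) ≡ n
length-range n = trans (length-map suc (upTo n)) (length-upTo n)

length-↭-range : ∀ {n ρ} → ρ ↭ range n → length ρ ≡ n
length-↭-range {n} ρ↭ = trans (↭-length ρ↭) (length-range n)

Unique-range : ∀ n → Unique (range n)
Unique-range n = Uₚ.map⁺ suc-injective (Uₚ.upTo⁺ n)

range-∈ : ∀ {n v} → v ∈ range n → ∃[ j ] v ≡ suc j × j < n
range-∈ v∈ = let j , j∈ , v≡ = ∈-map⁻ suc v∈ in j , v≡ , ∈-upTo⁻ j∈

range-bounds : ∀ n → All (λ j → 0 < j × j ≤ n) (range n)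
range-bounds n = All.tabulate λ j∈ → let _ , j≡ , k<n = range-∈ j∈ in
  subst (λ j → 0 < j × j ≤ n) (sym j≡) (s≤s z≤n , k<n)

reverse-range-suc : ∀ m → reverse (range (suc m)) ≡ suc m ∷ reverse (range m)
reverse-range-suc m = trans (cong reverse (range-suc m)) (reverse-++ (range m) [ suc m ])

reverse-range-descending : ∀ n → AllPairs _>_ (reverse (range n))
reverse-range-descending zero    = []
reverse-range-descending (suc m) rewrite reverse-range-suc m =
  All.tabulate (λ j∈ → s≤s (proj₂ (All.lookup (range-bounds m) (∈-reverse⁻ (range m) j∈)))) ∷
  reverse-range-descending m

descending-split : ∀ {c xs} → AllPairs _>_ xs → c ∈ xs → xs ≡ filter (c <?_) xs ++ c ∷ filter (_<? c) xs
descending-split {c} {x ∷ xs} (xs<x ∷ _) (here refl)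
  rewrite filter-reject (c <?_) {c} {xs} (<-irrefl refl) | filter-reject (_<? c) {c} {xs} (<-irrefl refl)
        | filter-none (c <?_) (All.map (λ y<c c<y → <-asym y<c c<y) xs<x) | filter-all (_<? c) xs<x = refl
descending-split {c} {x ∷ xs} (xs<x ∷ desc) (there c∈)
  rewrite filter-accept (c <?_) {x} {xs} (All.lookup xs<x c∈)
        | filter-reject (_<? c) {x} {xs} (<⇒≯ (All.lookup xs<x c∈)) = cong (x ∷_) (descending-split desc c∈)

-- Stack sorting and postorders of decreasing binary trees

module _ {P : ℕ → Set} (P? : Decidable P) where

  break-none : ∀ xs {L} → break P? xs ≡ (L , []) → All (∁ P) xs
  break-none []       refl = []
  break-none (x ∷ xs) e with P? x
  break-none (x ∷ xs) () | yes _
  ... | no ¬px with break P? xs in eq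
  break-none (x ∷ xs) refl | no ¬px | (_ , []) = ¬px ∷ break-none xs eq

  break-some : ∀ xs {L m R} → break P? xs ≡ (L , m ∷ R) → xs ≡ L ++ m ∷ R × P m
  break-some (x ∷ xs) e with P? x
  break-some (x ∷ xs) refl | yes px = refl , px
  ... | no _ with break P? xs in eq
  break-some (x ∷ xs) refl | no _ | (_ , _ ∷ _) with break-some xs eq
  ... | xs≡ , pm = cong (x ∷_) xs≡ , pm

  break-first : ∀ L {m} R → All (∁ P) L → P m → break P? (L ++ m ∷ R) ≡ (L , m ∷ R)
  break-first [] {m} R [] pm with P? m
  ... | yes _  = refl
  ... | no ¬pm = ⊥-elim (¬pm pm)
  break-first (x ∷ L) R (¬px ∷ ¬pL) pm with P? x
  ... | yes px = ⊥-elim (¬px px)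
  ... | no _ rewrite break-first L R ¬pL pm = refl

maxL-upper : ∀ xs → All (_≤ maxL xs) xs
maxL-upper []       = []
maxL-upper (x ∷ xs) =
  m≤m⊔n x (maxL xs) ∷ All.map (λ y≤ → ≤-trans y≤ (m≤n⊔m x (maxL xs))) (maxL-upper xs)

maxL-least : ∀ {m} xs → All (_≤ m) xs → maxL xs ≤ m
maxL-least []       []          = z≤n
maxL-least (x ∷ xs) (x≤ ∷ xs≤) = ⊔-lub x≤ (maxL-least xs xs≤)

maxL-∈ : ∀ x xs → maxL (x ∷ xs) ∈ x ∷ xs
maxL-∈ x [] rewrite ⊔-identityʳ x = here refl
maxL-∈ x (y ∷ xs) with ⊔-sel x (maxL (y ∷ xs))
... | inj₁ e = here e
... | inj₂ e rewrite e = there (maxL-∈ y xs)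

maxL-peak : ∀ L m R → All (_< m) L → All (_< m) R → maxL (L ++ m ∷ R) ≡ m
maxL-peak L m R L<m R<m = ≤-antisym
  (maxL-least (L ++ m ∷ R) (Allₚ.++⁺ (All.map <⇒≤ L<m) (≤-refl ∷ All.map <⇒≤ R<m)))
  (All.lookup (maxL-upper (L ++ m ∷ R)) (∈-++⁺ʳ L (here refl)))

data Postorder : List ℕ → Set where
  []   : Postorder []
  node : ∀ {X Y m} → Postorder X → Postorder Y → All (_< m) X → All (_< m) Y →
         Postorder (X ++ Y ++ [ m ])

PostorderPerm : List ℕ → Set
PostorderPerm π = Postorder π × IsPermutation π

sFuel-break : ∀ k x xs {L m R} → break (maxL (x ∷ xs) ≟_) (x ∷ xs) ≡ (L , m ∷ R) →
  sFuel (suc k) (x ∷ xs) ≡ sFuel k L ++ sFuel k R ++ [ m ]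
sFuel-break k x xs eq with break (maxL (x ∷ xs) ≟_) (x ∷ xs)
sFuel-break k x xs refl | (_ , _ ∷ _) = refl

sFuel-peak : ∀ k L m R → All (_< m) L → All (_< m) R →
  sFuel (suc k) (L ++ m ∷ R) ≡ sFuel k L ++ sFuel k R ++ [ m ]
sFuel-peak k L m R L<m R<m = go (L ++ m ∷ R) refl
  where
  breaks-at-m : break (maxL (L ++ m ∷ R) ≟_) (L ++ m ∷ R) ≡ (L , m ∷ R)
  breaks-at-m rewrite maxL-peak L m R L<m R<m =
    break-first (m ≟_) L R (All.map (λ x<m m≡x → <⇒≢ x<m (sym m≡x)) L<m) refl
  go : ∀ xs → xs ≡ L ++ m ∷ R → sFuel (suc k) xs ≡ sFuel k L ++ sFuel k R ++ [ m ]
  go []       e with () ← ++-conicalʳ L (m ∷ R) (sym e)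
  go (x ∷ xs) e = sFuel-break k x xs (subst (λ ys → break (maxL ys ≟_) ys ≡ (L , m ∷ R)) (sym e) breaks-at-m)

↭-peak : ∀ {L R X Y : List ℕ} m → L ↭ X → R ↭ Y → L ++ m ∷ R ↭ X ++ Y ++ [ m ]
↭-peak {X = X} {Y} m L↭X R↭Y =
  ↭-trans (++⁺ʳ _ L↭X) (++⁺ˡ X (↭-trans (prep m R↭Y) (∷↭∷ʳ m Y)))

sFuel-↭ : ∀ k xs → sFuel k xs ↭ xs
sFuel-↭ zero    xs = ↭-refl
sFuel-↭ (suc k) [] = ↭-refl
sFuel-↭ (suc k) (x ∷ xs) with break (maxL (x ∷ xs) ≟_) (x ∷ xs) in eq
... | (_ , [])    = ↭-refl
... | (L , m ∷ R) =
  subst (sFuel k L ++ sFuel k R ++ [ m ] ↭_) (sym (proj₁ (break-some (maxL (x ∷ xs) ≟_) (x ∷ xs) eq)))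
                      (↭-sym (↭-peak m (↭-sym (sFuel-↭ k L)) (↭-sym (sFuel-↭ k R))))

below-max : ∀ L m R → Unique (L ++ m ∷ R) → m ≡ maxL (L ++ m ∷ R) → All (_< m) L × All (_< m) R
below-max L m R u m≡max = All.tabulate (λ z∈ → below (∈-++⁺ˡ z∈) (λ { refl → m∉L z∈ })) ,
                          All.tabulate (λ z∈ → below (∈-++⁺ʳ L (there z∈)) (λ { refl → m∉R z∈ }))
  where
  m∉L = proj₁ (Unique-∷-middle L u)
  m∉R = proj₂ (Unique-∷-middle L u)
  below : ∀ {z} → z ∈ L ++ m ∷ R → z ≢ m → z < m
  below z∈ z≢m = ≤∧≢⇒< (subst (_ ≤_) (sym m≡max) (All.lookup (maxL-upper _) z∈)) z≢m

sFuel-postorder : ∀ k xs → Unique xs → length xs ≤ k → Postorder (sFuel k xs)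
sFuel-postorder zero    [] _ _ = []
sFuel-postorder (suc k) [] _ _ = []
sFuel-postorder (suc k) (x ∷ xs) u len with break (maxL (x ∷ xs) ≟_) (x ∷ xs) in eq
... | (_ , []) = ⊥-elim (All.lookup (break-none (maxL (x ∷ xs) ≟_) (x ∷ xs) eq) (maxL-∈ x xs) refl)
... | (L , m ∷ R) with break-some (maxL (x ∷ xs) ≟_) (x ∷ xs) eq
... | xs≡ , max≡m =
  node (sFuel-postorder k L uL (proj₁ lens)) (sFuel-postorder k R uR (proj₂ lens))
       (All-resp-↭ (↭-sym (sFuel-↭ k L)) (proj₁ L,R<m)) (All-resp-↭ (↭-sym (sFuel-↭ k R)) (proj₂ L,R<m))
  where
  u′ : Unique (L ++ m ∷ R)
  u′ = subst Unique xs≡ u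
  uL : Unique L
  uL = Unique-resp-⊆ (Sub.++⁺ʳ (m ∷ R) ⊆-refl) u′
  uR : Unique R
  uR = Unique-resp-⊆ (Sub.++⁺ˡ (L ++ [ m ]) ⊆-refl) (subst Unique (sym (∷ʳ-++ L m R)) u′)
  lens = length-++-∷-≤ L m R (subst (λ ys → length ys ≤ suc k) xs≡ len)
  L,R<m = below-max L m R u′ (trans (sym max≡m) (cong maxL xs≡))

inorder : ∀ {π} → Postorder π → List ℕ
inorder []                       = []
inorder (node {m = m} dX dY _ _) = inorder dX ++ m ∷ inorder dY

inorder-↭ : ∀ {π} (d : Postorder π) → inorder d ↭ π
inorder-↭ []                       = ↭-refl
inorder-↭ (node {m = m} dX dY _ _) = ↭-peak m (inorder-↭ dX) (inorder-↭ dY)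

sFuel-inorder : ∀ {π} (d : Postorder π) k → length (inorder d) ≤ k → sFuel k (inorder d) ≡ π
sFuel-inorder [] zero    _ = refl
sFuel-inorder [] (suc k) _ = refl
sFuel-inorder (node {m = m} dX dY _ _) zero len
  with () ← subst (_≤ 0) (trans (length-++ (inorder dX)) (+-suc (length (inorder dX)) _)) len
sFuel-inorder (node {X} {Y} {m} dX dY X<m Y<m) (suc k) len =
  trans (sFuel-peak k (inorder dX) m (inorder dY) (below dX X<m) (below dY Y<m))
        (cong₂ _++_ (sFuel-inorder dX k (proj₁ lens)) (cong (_++ [ m ]) (sFuel-inorder dY k (proj₂ lens))))
  where
  lens = length-++-∷-≤ (inorder dX) m (inorder dY) len
  below : ∀ {Z} (dZ : Postorder Z) → All (_< m) Z → All (_< m) (inorder dZ)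
  below dZ = All-resp-↭ (↭-sym (inorder-↭ dZ))

Sorted⇒PostorderPerm : ∀ {π} → Sorted π → PostorderPerm π
Sorted⇒PostorderPerm (σ , (u , pos) , refl) =
  sFuel-postorder (length σ) σ u ≤-refl ,
  Unique-resp-↭ (↭-sym (sFuel-↭ (length σ) σ)) u , All-resp-↭ (↭-sym (sFuel-↭ (length σ) σ)) pos

PostorderPerm⇒Sorted : ∀ {π} → PostorderPerm π → Sorted π
PostorderPerm⇒Sorted (d , u , pos) =
  inorder d ,
  (Unique-resp-↭ (↭-sym (inorder-↭ d)) u , All-resp-↭ (↭-sym (inorder-↭ d)) pos) ,
  sFuel-inorder d _ ≤-refl

-- Relabelling the entries on both sides of a fixed entry

-- Each subtree of a postorder reading of A ++ i ∷ B occupies a segment, which lies inside A,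
-- inside B, or around i.
data Within (A : List ℕ) (i : ℕ) (B : List ℕ) (ρ : List ℕ) : Set where
  inside-A : All (_∈ A) ρ → Within A i B ρ
  inside-B : All (_∈ B) ρ → Within A i B ρ
  around-i : ∀ pre post → ρ ≡ pre ++ i ∷ post → All (_∈ A) pre → All (_∈ B) post → Within A i B ρ

module _ {A : List ℕ} {i : ℕ} {B : List ℕ} where

  Within-++ : ∀ X {Z} → Within A i B (X ++ Z) → Within A i B X × Within A i B Z
  Within-++ X (inside-A a) = inside-A (Allₚ.++⁻ˡ X a) , inside-A (Allₚ.++⁻ʳ X a)
  Within-++ X (inside-B b) = inside-B (Allₚ.++⁻ˡ X b) , inside-B (Allₚ.++⁻ʳ X b)
  Within-++ X (around-i pre post e a b) with ++-≡-++-∷ X e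
  ... | inj₁ (w , X≡ , refl) = around-i pre w X≡ a (Allₚ.++⁻ˡ w b) , inside-B (Allₚ.++⁻ʳ w b)
  ... | inj₂ (w , refl , Z≡) = inside-A (Allₚ.++⁻ˡ X a) , around-i w post Z≡ (Allₚ.++⁻ʳ X a) b

  Within-⊆ : ∀ {ρ} → Within A i B ρ → All (_∈ A ++ i ∷ B) ρ
  Within-⊆ (inside-A a) = All.map ∈-++⁺ˡ a
  Within-⊆ (inside-B b) = All.map (∈-++⁺ʳ A ∘ there) b
  Within-⊆ (around-i pre post refl a b) =
    Allₚ.++⁺ (All.map ∈-++⁺ˡ a) (∈-++⁺ʳ A (here refl) ∷ All.map (∈-++⁺ʳ A ∘ there) b)

≤-peak : ∀ {X Y m z} → All (_< m) X → All (_< m) Y → z ∈ X ++ Y ++ [ m ] → z ≤ m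
≤-peak {X} {Y} X<m Y<m z∈ with ∈-++⁻ X z∈
... | inj₁ z∈X = <⇒≤ (All.lookup X<m z∈X)
... | inj₂ z∈Ym with ∈-++⁻ Y z∈Ym
...   | inj₁ z∈Y         = <⇒≤ (All.lookup Y<m z∈Y)
...   | inj₂ (here refl) = ≤-refl

module Relabel (A : List ℕ) (i : ℕ) (B : List ℕ) (F : ℕ → ℕ)
  (fixed : ∀ {x} → x ∈ A ++ i ∷ B → i ≤ x → F x ≡ x)
  (below : ∀ {x} → x ∈ A ++ i ∷ B → x < i → F x < i)
  (mono-A : ∀ {x y} → x ∈ A → y ∈ A → x < y → y < i → F x < F y)
  (mono-B : ∀ {x y} → x ∈ B → y ∈ B → x < y → y < i → F x < F y) where

  private
    π = A ++ i ∷ B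

  Kept : ℕ → ℕ → Set
  Kept x m = i ≤ m ⊎ (x ∈ A × m ∈ A) ⊎ (x ∈ B × m ∈ B)

  F-mono : ∀ {x m} → x ∈ π → m ∈ π → x < m → Kept x m → F x < F m
  F-mono {x} {m} x∈ m∈ x<m (inj₁ i≤m) rewrite fixed m∈ i≤m with i ≤? x
  ... | yes i≤x = subst (_< m) (sym (fixed x∈ i≤x)) x<m
  ... | no  i≰x = <-≤-trans (below x∈ (≰⇒> i≰x)) i≤m
  F-mono {x} {m} x∈ m∈ x<m (inj₂ same-side) with i ≤? m | same-side
  ... | yes i≤m | _                    = F-mono x∈ m∈ x<m (inj₁ i≤m)
  ... | no  i≰m | inj₁ (x∈A , m∈A) = mono-A x∈A m∈A x<m (≰⇒> i≰m)
  ... | no  i≰m | inj₂ (x∈B , m∈B) = mono-B x∈B m∈B x<m (≰⇒> i≰m)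

  kept-in-node : ∀ {X Y m} → All (_< m) X → All (_< m) Y → Within A i B (X ++ Y ++ [ m ]) →
    ∀ {x} → x ∈ X ++ Y ++ [ m ] → Kept x m
  kept-in-node {X} {Y} {m} X<m Y<m (inside-A a) x∈ =
    inj₂ (inj₁ (All.lookup a x∈ , All.lookup a (∈-++⁺ʳ X (∈-++⁺ʳ Y (here refl)))))
  kept-in-node {X} {Y} {m} X<m Y<m (inside-B b) x∈ =
    inj₂ (inj₂ (All.lookup b x∈ , All.lookup b (∈-++⁺ʳ X (∈-++⁺ʳ Y (here refl)))))
  kept-in-node X<m Y<m (around-i pre post e _ _) _ =
    inj₁ (≤-peak X<m Y<m (subst (i ∈_) (sym e) (∈-++⁺ʳ pre (here refl))))

  postorder : ∀ {ρ} → Postorder ρ → Within A i B ρ → Postorder (map F ρ)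
  postorder [] _ = []
  postorder (node {X} {Y} {m} dX dY X<m Y<m) w =
    subst Postorder (sym (trans (map-++ F X _) (cong (map F X ++_) (map-++ F Y _))))
      (node (postorder dX (proj₁ wX,wY)) (postorder dY (proj₂ wX,wY))
            (Allₚ.map⁺ (All.tabulate (λ x∈ → kept (∈-++⁺ˡ x∈) (All.lookup X<m x∈))))
            (Allₚ.map⁺ (All.tabulate (λ y∈ → kept (∈-++⁺ʳ X (∈-++⁺ˡ y∈)) (All.lookup Y<m y∈)))))
    where
    wX,wYm = Within-++ X w
    wX,wY = proj₁ wX,wYm , proj₁ (Within-++ Y (proj₂ wX,wYm))
    in-π = Within-⊆ w
    kept : ∀ {x} → x ∈ X ++ Y ++ [ m ] → x < m → F x < F m
    kept x∈ x<m = F-mono (All.lookup in-π x∈) (All.lookup in-π (∈-++⁺ʳ X (∈-++⁺ʳ Y (here refl)))) x<m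
                    (kept-in-node X<m Y<m w x∈)

  postorderPerm : PostorderPerm π → (∀ {x y} → x ∈ π → y ∈ π → F x ≡ F y → x ≡ y) →
    (∀ {x} → x ∈ π → 0 < F x) → PostorderPerm (map F π)
  postorderPerm (d , u , _) inj pos =
    postorder d (around-i A B refl (All.tabulate (λ x∈ → x∈)) (All.tabulate (λ x∈ → x∈))) ,
    Unique-map⁺ F inj u , Allₚ.map⁺ (All.tabulate pos)

record SideRelabelling (A : List ℕ) (i : ℕ) (B : List ℕ) (f g : ℕ → ℕ) : Set where
  field
    fixed-f : ∀ {x} → i ≤ x → f x ≡ x
    fixed-g : ∀ {x} → i ≤ x → g x ≡ x
    range-f : ∀ {x} → x ∈ A → x < i → 0 < f x × f x < i
    range-g : ∀ {x} → x ∈ B → x < i → 0 < g x × g x < i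
    mono-f  : ∀ {x y} → x ∈ A → y ∈ A → x < y → y < i → f x < f y
    mono-g  : ∀ {x y} → x ∈ B → y ∈ B → x < y → y < i → g x < g y
    apart   : ∀ {x y} → x ∈ A → y ∈ B → x < i → y < i → f x ≢ g y

module RelabelSides {A i B f g} (r : SideRelabelling A i B f g)
  (u : Unique (A ++ i ∷ B)) (pos : All (0 <_) (A ++ i ∷ B)) where

  open SideRelabelling r

  private
    π = A ++ i ∷ B

  F : ℕ → ℕ
  F x = if does (x ∈? A) then f x else g x

  F-A : ∀ {x} → x ∈ A → F x ≡ f x
  F-A {x} x∈A with x ∈? A
  ... | yes _    = refl
  ... | no  x∉A = ⊥-elim (x∉A x∈A)

  F-B : ∀ {x} → x ∉ A → F x ≡ g x
  F-B {x} x∉A with x ∈? A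
  ... | yes x∈A = ⊥-elim (x∉A x∈A)
  ... | no  _    = refl

  B∉A : ∀ {x} → x ∈ B → x ∉ A
  B∉A x∈B x∈A = Unique-++⁻-disjoint A u x∈A (there x∈B)

  i∉A : i ∉ A
  i∉A = proj₁ (Unique-∷-middle A u)

  data Side (x : ℕ) : Set where
    left  : x ∈ A → Side x
    mid   : x ≡ i → Side x
    right : x ∈ B → Side x

  side : ∀ {x} → x ∈ π → Side x
  side x∈ with ∈-++⁻ A x∈
  ... | inj₁ x∈A         = left x∈A
  ... | inj₂ (here x≡i)  = mid x≡i
  ... | inj₂ (there x∈B) = right x∈B

  fixed : ∀ {x} → x ∈ π → i ≤ x → F x ≡ x
  fixed {x} _ i≤x with x ∈? A
  ... | yes _ = fixed-f i≤x
  ... | no  _ = fixed-g i≤x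

  F-range : ∀ {x} → x ∈ π → x < i → 0 < F x × F x < i
  F-range x∈ x<i with side x∈
  ... | left  x∈A  rewrite F-A x∈A         = range-f x∈A x<i
  ... | mid   refl = ⊥-elim (<-irrefl refl x<i)
  ... | right x∈B rewrite F-B (B∉A x∈B) = range-g x∈B x<i

  mono-A : ∀ {x y} → x ∈ A → y ∈ A → x < y → y < i → F x < F y
  mono-A x∈A y∈A rewrite F-A x∈A | F-A y∈A = mono-f x∈A y∈A

  mono-B : ∀ {x y} → x ∈ B → y ∈ B → x < y → y < i → F x < F y
  mono-B x∈B y∈B rewrite F-B (B∉A x∈B) | F-B (B∉A y∈B) = mono-g x∈B y∈B

  F-≢ : ∀ {x y} → x ∈ π → y ∈ π → x < y → F x ≢ F y
  F-≢ {x} {y} x∈ y∈ x<y Fx≡Fy with i ≤? x | i ≤? y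
  ... | yes i≤x | yes i≤y = <-irrefl (trans (sym (fixed x∈ i≤x)) (trans Fx≡Fy (fixed y∈ i≤y))) x<y
  ... | yes i≤x | no  i≰y = i≰y (≤-trans i≤x (<⇒≤ x<y))
  ... | no  i≰x | yes i≤y =
    <-irrefl Fx≡Fy
      (subst (F x <_) (sym (fixed y∈ i≤y)) (<-≤-trans (proj₂ (F-range x∈ (≰⇒> i≰x))) i≤y))
  ... | no  i≰x | no  i≰y with side x∈ | side y∈
  ...   | mid refl    | _           = i≰x ≤-refl
  ...   | _           | mid refl    = i≰y ≤-refl
  ...   | left  x∈A   | left  y∈A   = <-irrefl Fx≡Fy (mono-A x∈A y∈A x<y (≰⇒> i≰y))
  ...   | right x∈B   | right y∈B   = <-irrefl Fx≡Fy (mono-B x∈B y∈B x<y (≰⇒> i≰y))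
  ...   | left  x∈A   | right y∈B   =
    apart x∈A y∈B (≰⇒> i≰x) (≰⇒> i≰y) (trans (sym (F-A x∈A)) (trans Fx≡Fy (F-B (B∉A y∈B))))
  ...   | right x∈B   | left  y∈A   =
    apart y∈A x∈B (≰⇒> i≰y) (≰⇒> i≰x) (trans (sym (F-A y∈A)) (trans (sym Fx≡Fy) (F-B (B∉A x∈B))))

  F-injective : ∀ {x y} → x ∈ π → y ∈ π → F x ≡ F y → x ≡ y
  F-injective {x} {y} x∈ y∈ Fx≡Fy with <-cmp x y
  ... | tri< x<y _ _ = ⊥-elim (F-≢ x∈ y∈ x<y Fx≡Fy)
  ... | tri≈ _ x≡y _ = x≡y
  ... | tri> _ _ y<x = ⊥-elim (F-≢ y∈ x∈ y<x (sym Fx≡Fy))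

  F-positive : ∀ {x} → x ∈ π → 0 < F x
  F-positive {x} x∈ with i ≤? x
  ... | yes i≤x = subst (0 <_) (sym (fixed x∈ i≤x)) (All.lookup pos x∈)
  ... | no  i≰x = proj₁ (F-range x∈ (≰⇒> i≰x))

  map-F : map F π ≡ map f A ++ i ∷ map g B
  map-F = trans (map-++ F A (i ∷ B))
    (cong₂ _++_ (map-cong-local (All.tabulate F-A))
                (cong₂ _∷_ (trans (F-B i∉A) (fixed-g ≤-refl)) (map-cong-local (All.tabulate (F-B ∘ B∉A)))))

  open Relabel A i B F fixed (λ x∈ x<i → proj₂ (F-range x∈ x<i)) mono-A mono-B public

relabel-sides : ∀ {A i B f g} → SideRelabelling A i B f g →
  PostorderPerm (A ++ i ∷ B) → PostorderPerm (map f A ++ i ∷ map g B)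
relabel-sides r p@(_ , u , pos) =
  subst PostorderPerm map-F (postorderPerm p F-injective F-positive)
  where open RelabelSides r u pos

-- swuᵢ and swdᵢ

count>-< : ∀ L {x y} → x < y → y ∈ L → count> y L < count> x L
count>-< L x<y y∈ = length-filter-< (_ <?_) (_ <?_) (<-trans x<y) L y∈ x<y (<-irrefl refl)

count<-< : ∀ R {x y} → x < y → x ∈ R → count< x R < count< y R
count<-< R x<y x∈ = length-filter-< (_<? _) (_<? _) (λ z<x → <-trans z<x x<y) R x∈ x<y (<-irrefl refl)

entries-below-count : ∀ A i B → Unique (A ++ i ∷ B) → All (0 <_) (A ++ i ∷ B) →
  length (filter (_<? i) A) + length (filter (_<? i) B) < i
entries-below-count A i B u pos =
  subst (_≤ i) (cong suc (trans (cong length (filter-++ (_<? i) A B)) (length-++ (filter (_<? i) A))))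
    (Unique-below-length i (0 ∷ filter (_<? i) (A ++ B)) (0∉ ∷ Uₚ.filter⁺ _ uAB)
      (All.lookup pos (∈-++⁺ʳ A (here refl)) ∷ Allₚ.all-filter (_<? i) (A ++ B)))
  where
  A++B⊆ : A ++ B ⊆ A ++ i ∷ B
  A++B⊆ = Sub.++⁺ ⊆-refl (i ∷ʳ ⊆-refl)
  uAB : Unique (A ++ B)
  uAB = Unique-resp-⊆ A++B⊆ u
  0∉ : All (0 ≢_) (filter (_<? i) (A ++ B))
  0∉ = All.tabulate λ z∈ → <⇒≢ (All.lookup pos (⊆-lookup A++B⊆ (proj₁ (∈-filter⁻ (_<? i) z∈))))

swuˡ : ℕ → List ℕ → ℕ → ℕ
swuˡ i L x = if does (x <? i) then i ∸ suc (count> x L) else x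

swuʳ : ℕ → List ℕ → ℕ → ℕ
swuʳ i R x = if does (x <? i) then suc (count< x R) else x

swuᵢ-break : ∀ i π {A j B} → break (i ≟_) π ≡ (A , j ∷ B) →
  swuᵢ i π ≡ map (swuˡ i (filter (_<? i) A)) A ++ j ∷ map (swuʳ i (filter (_<? i) B)) B
swuᵢ-break i π eq with break (i ≟_) π
swuᵢ-break i π refl | (_ , _ ∷ _) = refl

module _ (i : ℕ) {x : ℕ} where

  swuˡ-fixed : ∀ L → i ≤ x → swuˡ i L x ≡ x
  swuˡ-fixed L i≤x = if-does-no (x <? i) (≤⇒≯ i≤x)

  swuʳ-fixed : ∀ R → i ≤ x → swuʳ i R x ≡ x
  swuʳ-fixed R i≤x = if-does-no (x <? i) (≤⇒≯ i≤x)

  swuˡ-below : ∀ L → x < i → swuˡ i L x ≡ i ∸ suc (count> x L)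
  swuˡ-below L = if-does-yes (x <? i)

  swuʳ-below : ∀ R → x < i → swuʳ i R x ≡ suc (count< x R)
  swuʳ-below R = if-does-yes (x <? i)

  swuˡ-range : ∀ L → x ∈ L → x < i → length L < i →
    i ∸ length L ≤ swuˡ i L x × 0 < swuˡ i L x × swuˡ i L x < i
  swuˡ-range L x∈ x<i |L|<i rewrite swuˡ-below L x<i =
    ∸-monoʳ-≤ i c<|L| ,
    m<n⇒0<n∸m (<-≤-trans (s≤s c<|L|) |L|<i) ,
    ∸-monoʳ-< {o = 0} (s≤s z≤n) (≤-trans c<|L| (<⇒≤ |L|<i))
    where c<|L| = length-filter-∈ (x <?_) L x∈ (<-irrefl refl)

  swuʳ-range : ∀ R → x ∈ R → x < i → 0 < swuʳ i R x × swuʳ i R x ≤ length R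
  swuʳ-range R x∈ x<i rewrite swuʳ-below R x<i = s≤s z≤n , length-filter-∈ (_<? x) R x∈ (<-irrefl refl)

swuˡ-mono : ∀ i L {x y} → y ∈ L → x < y → y < i → length L < i → swuˡ i L x < swuˡ i L y
swuˡ-mono i L {x} {y} y∈ x<y y<i |L|<i
  rewrite swuˡ-below i L (<-trans x<y y<i) | swuˡ-below i L y<i =
  ∸-monoʳ-< (s≤s (count>-< L x<y y∈)) (≤-<-trans (length-filter (x <?_) L) |L|<i)

swuʳ-mono : ∀ i R {x y} → x ∈ R → x < y → y < i → swuʳ i R x < swuʳ i R y
swuʳ-mono i R {x} {y} x∈ x<y y<i
  rewrite swuʳ-below i R (<-trans x<y y<i) | swuʳ-below i R y<i = s≤s (count<-< R x<y x∈)

swu-relabelling : ∀ {A i B L R} →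
  (∀ {x} → x ∈ A → x < i → x ∈ L) → (∀ {x} → x ∈ B → x < i → x ∈ R) →
  length L + length R < i → SideRelabelling A i B (swuˡ i L) (swuʳ i R)
swu-relabelling {A} {i} {B} {L} {R} A⊆L B⊆R |L|+|R|<i = record
  { fixed-f = swuˡ-fixed i L
  ; fixed-g = swuʳ-fixed i R
  ; range-f = λ x∈ x<i → proj₂ (swuˡ-range i L (A⊆L x∈ x<i) x<i |L|<i)
  ; range-g = λ x∈ x<i → let 0< , ≤|R| = swuʳ-range i R (B⊆R x∈ x<i) x<i in
                          0< , <-≤-trans (s≤s ≤|R|) |R|<i
  ; mono-f  = λ _ y∈ x<y y<i → swuˡ-mono i L (A⊆L y∈ y<i) x<y y<i |L|<i
  ; mono-g  = λ x∈ _ x<y y<i → swuʳ-mono i R (B⊆R x∈ (<-trans x<y y<i)) x<y y<i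
  ; apart   = λ x∈ y∈ x<i y<i fx≡gy → <-irrefl (sym fx≡gy)
      (≤-<-trans (proj₂ (swuʳ-range i R (B⊆R y∈ y<i) y<i))
        (<-≤-trans |R|<i∸|L| (proj₁ (swuˡ-range i L (A⊆L x∈ x<i) x<i |L|<i))))
  }
  where
  |L|<i = ≤-<-trans (m≤m+n (length L) (length R)) |L|+|R|<i
  |R|<i = ≤-<-trans (m≤n+m (length R) (length L)) |L|+|R|<i
  |R|<i∸|L| : length R < i ∸ length L
  |R|<i∸|L| = subst (_< i ∸ length L) (m+n∸m≡n (length L) (length R))
                (∸-monoˡ-< |L|+|R|<i (m≤m+n (length L) (length R)))

SideRelabelling-swap : ∀ {A i B f g} → SideRelabelling A i B f g → SideRelabelling B i A g f
SideRelabelling-swap r = record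
  { fixed-f = fixed-g ; fixed-g = fixed-f ; range-f = range-g ; range-g = range-f
  ; mono-f = mono-g ; mono-g = mono-f ; apart = λ x∈ y∈ x<i y<i → apart y∈ x∈ y<i x<i ∘ sym }
  where open SideRelabelling r

swuᵢ-preserves : ∀ i π → PostorderPerm π → PostorderPerm (swuᵢ i π)
swuᵢ-preserves i π p with break (i ≟_) π in eq
... | (_ , [])    = p
... | (A , _ ∷ B) with π≡ , refl ← break-some (i ≟_) π eq =
  relabel-sides (swu-relabelling (∈-filter⁺ (_<? i)) (∈-filter⁺ (_<? i)) (entries-below-count A i B u pos))
    (subst PostorderPerm π≡ p)
  where
  u = subst Unique π≡ (proj₁ (proj₂ p))
  pos = subst (All (0 <_)) π≡ (proj₂ (proj₂ p))

swdᵢ-preserves : ∀ i π → PostorderPerm π → PostorderPerm (swdᵢ i π)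
swdᵢ-preserves i π p with break (i ≟_) (reverse π) in eq
... | (_ , []) = subst PostorderPerm (sym (reverse-involutive π)) p
... | (A , _ ∷ B) with rπ≡ , refl ← break-some (i ≟_) (reverse π) eq =
  subst PostorderPerm (sym result≡)
    (relabel-sides (SideRelabelling-swap (swu-relabelling (∈-filter⁺ (_<? i) ∘ ∈-reverse⁻ A)
                                                            (∈-filter⁺ (_<? i) ∘ ∈-reverse⁻ B)
                                                            (entries-below-count A i B u pos)))
                   (subst PostorderPerm π≡ p))
  where
  L = filter (_<? i) A
  R = filter (_<? i) B
  π≡ : π ≡ reverse B ++ i ∷ reverse A
  π≡ = trans (sym (reverse-involutive π)) (trans (cong reverse rπ≡) (reverse-around A i B))
  u : Unique (A ++ i ∷ B)
  u = subst Unique rπ≡ (Unique-resp-↭ (↭-sym (↭-reverse π)) (proj₁ (proj₂ p)))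
  pos : All (0 <_) (A ++ i ∷ B)
  pos = subst (All (0 <_)) rπ≡ (All-resp-↭ (↭-sym (↭-reverse π)) (proj₂ (proj₂ p)))
  result≡ : reverse (map (swuˡ i L) A ++ i ∷ map (swuʳ i R) B) ≡
            map (swuʳ i R) (reverse B) ++ i ∷ map (swuˡ i L) (reverse A)
  result≡ = trans (reverse-around (map (swuˡ i L) A) i (map (swuʳ i R) B))
                  (cong₂ (λ X Y → X ++ i ∷ Y) (sym (reverse-map (swuʳ i R) B))
                                              (sym (reverse-map (swuˡ i L) A)))

-- Pivoting prefixes

pivotPrefix : List ℕ → List ℕ → List ℕ
pivotPrefix P []      = P
pivotPrefix P (v ∷ C) = filter (_<? v) P ++ filter (∁? (_<? v)) P ++ v ∷ C

pivot : ℕ → List ℕ → List ℕ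
pivot zero    ρ = ρ
pivot (suc k) ρ = pivotPrefix (take k ρ) (drop k ρ)

pivots : List ℕ → List ℕ
pivots ρ = foldr pivot ρ (range (length ρ))

pivotPrefix-↭ : ∀ P C → pivotPrefix P C ↭ P ++ C
pivotPrefix-↭ P []      = ↭-reflexive (sym (++-identityʳ P))
pivotPrefix-↭ P (v ∷ C) =
  subst (_↭ P ++ v ∷ C) (++-assoc (filter (_<? v) P) _ (v ∷ C))
    (++⁺ʳ (v ∷ C) (filter-++-filter-∁-↭ (_<? v) P))

pivot-↭ : ∀ j ρ → pivot j ρ ↭ ρ
pivot-↭ zero    ρ = ↭-refl
pivot-↭ (suc k) ρ = subst (pivot (suc k) ρ ↭_) (take++drop≡id k ρ) (pivotPrefix-↭ (take k ρ) (drop k ρ))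

foldr-pivot-↭ : ∀ js ρ → foldr pivot ρ js ↭ ρ
foldr-pivot-↭ []       ρ = ↭-refl
foldr-pivot-↭ (j ∷ js) ρ = ↭-trans (pivot-↭ j (foldr pivot ρ js)) (foldr-pivot-↭ js ρ)

pivots-↭ : ∀ ρ → pivots ρ ↭ ρ
pivots-↭ ρ = foldr-pivot-↭ (range (length ρ)) ρ

split-at : ∀ k (σ : List ℕ) → k < length σ → ∃[ P ] ∃[ v ] ∃[ C ] σ ≡ P ++ v ∷ C × length P ≡ k
split-at zero    (v ∷ C) _       = [] , v , C , refl , refl
split-at (suc k) (x ∷ σ) (s≤s k<) with P , v , C , refl , refl ← split-at k σ k< =
  x ∷ P , v , C , refl , refl

take-length-++ : ∀ (P X : List ℕ) → take (length P) (P ++ X) ≡ P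
take-length-++ []      X = refl
take-length-++ (x ∷ P) X = cong (x ∷_) (take-length-++ P X)

drop-length-++ : ∀ (P X : List ℕ) → drop (length P) (P ++ X) ≡ X
drop-length-++ []      X = refl
drop-length-++ (x ∷ P) X = drop-length-++ P X

pivot-at : ∀ P (v : ℕ) C → pivot (suc (length P)) (P ++ v ∷ C) ≡ pivotPrefix P (v ∷ C)
pivot-at P v C = cong₂ pivotPrefix (take-length-++ P (v ∷ C)) (drop-length-++ P (v ∷ C))

pivot-++ʳ : ∀ k σ Z → k < length σ → pivot (suc k) (σ ++ Z) ≡ pivot (suc k) σ ++ Z
pivot-++ʳ k σ Z k< with P , v , C , refl , refl ← split-at k σ k< = begin
  pivot (suc (length P)) ((P ++ v ∷ C) ++ Z) ≡⟨ cong (pivot (suc (length P))) (++-assoc P (v ∷ C) Z) ⟩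
  pivot (suc (length P)) (P ++ v ∷ C ++ Z)   ≡⟨ pivot-at P v (C ++ Z) ⟩
  pivotPrefix P (v ∷ C ++ Z)                 ≡⟨ sym (trans (++-assoc (filter (_<? v) P) _ Z)
                  (cong (filter (_<? v) P ++_) (++-assoc (filter (∁? (_<? v)) P) (v ∷ C) Z))) ⟩
  pivotPrefix P (v ∷ C) ++ Z                 ≡⟨ cong (_++ Z) (sym (pivot-at P v C)) ⟩
  pivot (suc (length P)) (P ++ v ∷ C) ++ Z   ∎
  where open ≡-Reasoning

pivot-shift : ∀ {t} S ρ k → k < length ρ → All (_< t) S → All (t ≤_) ρ →
  pivot (length S + suc k) (S ++ ρ) ≡ S ++ pivot (suc k) ρ
pivot-shift S ρ k k< S<t t≤ρ with P , v , C , refl , refl ← split-at k ρ k< = begin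
  pivot (length S + suc (length P)) (S ++ P ++ v ∷ C)
    ≡⟨ cong₂ pivot (trans (+-suc (length S) (length P)) (cong suc (sym (length-++ S))))
                   (sym (++-assoc S P (v ∷ C))) ⟩
  pivot (suc (length (S ++ P))) ((S ++ P) ++ v ∷ C)
    ≡⟨ pivot-at (S ++ P) v C ⟩
  filter (_<? v) (S ++ P) ++ filter (∁? (_<? v)) (S ++ P) ++ v ∷ C
    ≡⟨ cong₂ (λ X Y → X ++ Y ++ v ∷ C)
             (trans (filter-++ (_<? v) S P) (cong (_++ filter (_<? v) P) (filter-all (_<? v) S<v)))
             (trans (filter-++ (∁? (_<? v)) S P)
                    (cong (_++ filter (∁? (_<? v)) P) (filter-none (∁? (_<? v)) ¬S≮v))) ⟩
  (S ++ filter (_<? v) P) ++ filter (∁? (_<? v)) P ++ v ∷ C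
    ≡⟨ ++-assoc S (filter (_<? v) P) _ ⟩
  S ++ pivotPrefix P (v ∷ C)
    ≡⟨ cong (S ++_) (sym (pivot-at P v C)) ⟩
  S ++ pivot (suc (length P)) (P ++ v ∷ C) ∎
  where
  open ≡-Reasoning
  S<v = All.map (λ s<t → <-≤-trans s<t (All.lookup t≤ρ (∈-++⁺ʳ P (here refl)))) S<t
  ¬S≮v = All.map (λ s<v s≮v → s≮v s<v) S<v

length-foldr-pivot : ∀ js ρ → length (foldr pivot ρ js) ≡ length ρ
length-foldr-pivot js ρ = ↭-length (foldr-pivot-↭ js ρ)

foldr-pivot-++ʳ : ∀ js σ Z → All (_≤ length σ) js → foldr pivot (σ ++ Z) js ≡ foldr pivot σ js ++ Z
foldr-pivot-++ʳ []            σ Z []           = refl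
foldr-pivot-++ʳ (zero ∷ js)   σ Z (_ ∷ js≤)    = foldr-pivot-++ʳ js σ Z js≤
foldr-pivot-++ʳ (suc k ∷ js)  σ Z (k< ∷ js≤)
  rewrite foldr-pivot-++ʳ js σ Z js≤ =
  pivot-++ʳ k (foldr pivot σ js) Z (subst (k <_) (sym (length-foldr-pivot js σ)) k<)

foldr-pivot-shift : ∀ {t} S js ρ → All (λ j → 0 < j × j ≤ length ρ) js → All (_< t) S → All (t ≤_) ρ →
  foldr pivot (S ++ ρ) (map (length S +_) js) ≡ S ++ foldr pivot ρ js
foldr-pivot-shift S []           ρ []               S<t t≤ρ = refl
foldr-pivot-shift S (suc k ∷ js) ρ ((_ , k<) ∷ js≤) S<t t≤ρ
  rewrite foldr-pivot-shift S js ρ js≤ S<t t≤ρ =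
  pivot-shift S (foldr pivot ρ js) k (subst (k <_) (sym (length-foldr-pivot js ρ)) k<) S<t
    (All-resp-↭ (↭-sym (foldr-pivot-↭ js ρ)) t≤ρ)

pivots-++ : ∀ {t} S L → All (_< t) S → All (t ≤_) L → pivots (S ++ L) ≡ pivots S ++ pivots L
pivots-++ S L S<t t≤L = begin
  foldr pivot (S ++ L) (range (length (S ++ L)))
    ≡⟨ cong (foldr pivot (S ++ L)) (trans (cong range (length-++ S)) (range-+ (length S) (length L))) ⟩
  foldr pivot (S ++ L) (range (length S) ++ map (length S +_) (range (length L)))
    ≡⟨ foldr-++ pivot (S ++ L) (range (length S)) _ ⟩
  foldr pivot (foldr pivot (S ++ L) (map (length S +_) (range (length L)))) (range (length S))
    ≡⟨ cong (λ ρ → foldr pivot ρ (range (length S)))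
            (foldr-pivot-shift S (range (length L)) L (range-bounds (length L)) S<t t≤L) ⟩
  foldr pivot (S ++ pivots L) (range (length S))
    ≡⟨ foldr-pivot-++ʳ (range (length S)) S (pivots L) (All.map proj₂ (range-bounds (length S))) ⟩
  pivots S ++ pivots L ∎
  where open ≡-Reasoning

pivots-snoc : ∀ τ y →
  pivots (τ ++ [ y ]) ≡ pivots (filter (_<? y) τ) ++ pivots (filter (∁? (_<? y)) τ) ++ [ y ]
pivots-snoc τ y = begin
  foldr pivot (τ ++ [ y ]) (range (length (τ ++ [ y ])))
    ≡⟨ cong (foldr pivot (τ ++ [ y ])) (trans (cong range (trans (length-++ τ) (+-comm m 1))) (range-suc m)) ⟩
  foldr pivot (τ ++ [ y ]) (range m ++ [ suc m ])
    ≡⟨ foldr-++ pivot (τ ++ [ y ]) (range m) [ suc m ] ⟩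
  foldr pivot (pivot (suc m) (τ ++ [ y ])) (range m)
    ≡⟨ cong (λ ρ → foldr pivot ρ (range m)) (trans (pivot-at τ y []) (sym (++-assoc Sm Lg [ y ]))) ⟩
  foldr pivot ((Sm ++ Lg) ++ [ y ]) (range m)
    ≡⟨ foldr-pivot-++ʳ (range m) (Sm ++ Lg) [ y ]
         (subst (λ k → All (_≤ k) (range m)) (sym |Sm++Lg|) (All.map proj₂ (range-bounds m))) ⟩
  foldr pivot (Sm ++ Lg) (range m) ++ [ y ]
    ≡⟨ cong (λ k → foldr pivot (Sm ++ Lg) (range k) ++ [ y ]) (sym |Sm++Lg|) ⟩
  pivots (Sm ++ Lg) ++ [ y ]
    ≡⟨ cong (_++ [ y ]) (pivots-++ Sm Lg Sm<y y≤Lg) ⟩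
  (pivots Sm ++ pivots Lg) ++ [ y ]
    ≡⟨ ++-assoc (pivots Sm) (pivots Lg) [ y ] ⟩
  pivots Sm ++ pivots Lg ++ [ y ] ∎
  where
  open ≡-Reasoning
  m = length τ
  Sm = filter (_<? y) τ
  Lg = filter (∁? (_<? y)) τ
  |Sm++Lg| : length (Sm ++ Lg) ≡ m
  |Sm++Lg| = ↭-length (filter-++-filter-∁-↭ (_<? y) τ)
  Sm<y : All (_< y) Sm
  Sm<y = Allₚ.all-filter (_<? y) τ
  y≤Lg : All (y ≤_) Lg
  y≤Lg = All.map ≮⇒≥ (Allₚ.all-filter (∁? (_<? y)) τ)

-- Pivoting 132-avoiding postorders

data Forest : ℕ → List ℕ → Set where
  []  : ∀ {k} → Forest k []
  _∷_ : ∀ {k X Y} → Postorder X → Forest k Y → Forest (suc k) (X ++ Y)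

Forest-suc : ∀ {k ρ} → Forest k ρ → Forest (suc k) ρ
Forest-suc []      = []
Forest-suc (d ∷ f) = d ∷ Forest-suc f

Forest-≤ : ∀ {k k′ ρ} → k ≤ k′ → Forest k ρ → Forest k′ ρ
Forest-≤ {k} k≤k′ f with o , refl ← m≤n⇒∃[o]m+o≡n k≤k′ = go o f
  where
  go : ∀ {k ρ} o → Forest k ρ → Forest (k + o) ρ
  go {k} zero    f rewrite +-identityʳ k = f
  go {k} (suc o) f rewrite +-suc k o     = Forest-suc (go o f)

Forest-++ : ∀ {a b X Y} → Forest a X → Forest b Y → Forest (a + b) (X ++ Y)
Forest-++ {a} {b} [] g = Forest-≤ (m≤n+m b a) g
Forest-++ (_∷_ {X = X₁} {Y₁} d f) g = subst (Forest _) (sym (++-assoc X₁ Y₁ _)) (d ∷ Forest-++ f g)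

Forest-1 : ∀ {X} → Postorder X → Forest 1 X
Forest-1 {X} d = subst (Forest 1) (++-identityʳ X) (d ∷ [])

Forest-0 : ∀ {ρ} → Forest 0 ρ → ρ ≡ []
Forest-0 [] = refl

Forest-1⇒Postorder : ∀ {ρ} → Forest 1 ρ → Postorder ρ
Forest-1⇒Postorder []                  = []
Forest-1⇒Postorder (_∷_ {X = X} d f) rewrite Forest-0 f | ++-identityʳ X = d

Forest-split : ∀ a {b ρ} → Forest (a + b) ρ → ∃[ P ] ∃[ Q ] ρ ≡ P ++ Q × Forest a P × Forest b Q
Forest-split zero    f                  = [] , _ , refl , [] , f
Forest-split (suc a) []                 = [] , [] , refl , [] , []
Forest-split (suc a) (_∷_ {X = X} d f) with P , Q , refl , fP , fQ ← Forest-split a f =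
  X ++ P , Q , sym (++-assoc X P Q) , d ∷ fP , fQ

Forest-first-block : ∀ {b ρ} → Forest b ρ → ρ ≢ [] → ∃[ b′ ] ∃[ B ] ∃[ Br ]
  b ≡ suc b′ × ρ ≡ B ++ Br × Postorder B × B ≢ [] × Forest b′ Br
Forest-first-block []                          ρ≢[] = ⊥-elim (ρ≢[] refl)
Forest-first-block (_∷_ {X = []} _ f)          ρ≢[]
  with b′ , B , Br , refl , ρ≡ , dB , B≢[] , fBr ← Forest-first-block f ρ≢[] =
  suc b′ , B , Br , refl , ρ≡ , dB , B≢[] , Forest-suc fBr
Forest-first-block (_∷_ {k} {x ∷ X} {Y} d f) _ = k , x ∷ X , Y , refl , refl , d , (λ ()) , f

Postorder-root : ∀ {Z m} → Postorder (Z ++ [ m ]) → All (_< m) Z × Forest 2 Z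
Postorder-root {Z} d = go d refl
  where
  go : ∀ {ρ m} → Postorder ρ → ρ ≡ Z ++ [ m ] → All (_< m) Z × Forest 2 Z
  go [] e with () ← ++-conicalʳ Z _ (sym e)
  go (node {X} {Y} {m′} dX dY X<m Y<m) e
    with refl , refl ← ∷ʳ-injective (X ++ Y) Z (trans (++-assoc X Y [ m′ ]) e) =
    Allₚ.++⁺ X<m Y<m , dX ∷ Forest-1 dY

Forest-2-root : ∀ {ρ m} → Forest 2 ρ → All (_< m) ρ → Postorder (ρ ++ [ m ])
Forest-2-root [] _ = node [] [] [] []
Forest-2-root {m = m} (_∷_ {X = X} {Y} d f) ρ<m =
  subst Postorder (sym (++-assoc X Y [ m ]))
    (node d (Forest-1⇒Postorder f) (Allₚ.++⁻ˡ X ρ<m) (Allₚ.++⁻ʳ X ρ<m))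

Forest-root-last : ∀ k {ρ y} → Forest (suc (suc k)) ρ → All (_< y) ρ → Forest (suc k) (ρ ++ [ y ])
Forest-root-last zero    f                       ρ<y = Forest-1 (Forest-2-root f ρ<y)
Forest-root-last (suc k) []                      _   = Forest-≤ (s≤s z≤n) (Forest-1 (node [] [] [] []))
Forest-root-last (suc k) {y = y} (_∷_ {X = X} {Y} d f) ρ<y =
  subst (Forest _) (sym (++-assoc X Y [ y ])) (d ∷ Forest-root-last k f (Allₚ.++⁻ʳ X ρ<y))

-- The two trees of C are hung below the leftmost leaf of B.
graft : ∀ {B} → Postorder B → B ≢ [] → ∀ {C t} → Forest 2 C → All (_< t) C → All (t <_) B →
  Postorder (C ++ B)
graft [] B≢[] = ⊥-elim (B≢[] refl)
graft (node {x ∷ X} {Y} {m} dX dY X<m Y<m) _ {C} {t} fC C<t t<B =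
  subst Postorder (++-assoc C (x ∷ X) (Y ++ [ m ]))
    (node (graft dX (λ ()) fC C<t (Allₚ.++⁻ˡ (x ∷ X) t<B)) dY
          (Allₚ.++⁺ (All.map (λ c<t → <-trans c<t t<m) C<t) X<m) Y<m)
  where t<m = All.lookup t<B (∈-++⁺ʳ (x ∷ X) (∈-++⁺ʳ Y (here refl)))
graft (node {[]} {y ∷ Y} {m} dX dY X<m Y<m) _ {C} {t} fC C<t t<B =
  subst Postorder (++-assoc C (y ∷ Y) [ m ])
    (node [] (graft dY (λ ()) fC C<t (Allₚ.++⁻ˡ (y ∷ Y) t<B)) []
          (Allₚ.++⁺ (All.map (λ c<t → <-trans c<t t<m) C<t) Y<m))
  where t<m = All.lookup t<B (∈-++⁺ʳ (y ∷ Y) (here refl))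
graft (node {[]} {[]} dX dY X<m Y<m) _ fC C<t (t<m ∷ []) =
  Forest-2-root fC (All.map (λ c<t → <-trans c<t t<m) C<t)

Forest-split-above : ∀ {k} P {Q t} → Forest k (P ++ Q) → All (t <_) P → All (_≤ t) Q →
  ∃[ a ] ∃[ b ] a + b ≤ k × Forest a P × Forest b Q
Forest-split-above P f = go P f refl
  where
  go : ∀ {k ρ} P {Q t} → Forest k ρ → ρ ≡ P ++ Q → All (t <_) P → All (_≤ t) Q →
    ∃[ a ] ∃[ b ] a + b ≤ k × Forest a P × Forest b Q
  go {k} [] f refl _ _ = 0 , k , ≤-refl , [] , f
  go (p ∷ P) [] () _ _
  go (p ∷ P) {Q} {t} (_∷_ {k} {X} {Y} d f) e t<P Q≤t with ++-≡-++ X e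
  ... | inj₂ (w , P≡ , Y≡)
    with a , b , a+b≤k , fw , fQ ← go w f Y≡ (Allₚ.++⁻ʳ X (subst (All _) P≡ t<P)) Q≤t =
    suc a , b , s≤s a+b≤k , subst (Forest (suc a)) (sym P≡) (d ∷ fw) , fQ
  ... | inj₁ (w , X≡ , Q≡) with initLast w
  ...   | [] = 1 , k , ≤-refl , Forest-1 (subst Postorder (trans X≡ (++-identityʳ (p ∷ P))) d) ,
               subst (Forest k) (sym Q≡) f
  -- the root z of the block X lies in Q, yet the block contains p > t ≥ z
  ...   | w′ ∷ʳ′ z = ⊥-elim (<-asym p<z (≤-<-trans z≤t (All.lookup t<P (here refl))))
    where
    p<z : p < z
    p<z = All.lookup (proj₁ (Postorder-root (subst Postorder (trans X≡ (sym (++-assoc (p ∷ P) w′ [ z ]))) d)))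
                     (here refl)
    z≤t : z ≤ t
    z≤t = All.lookup Q≤t (subst (z ∈_) (sym Q≡) (∈-++⁺ˡ (∈-++⁺ʳ w′ (here refl))))

Forest-init : ∀ {k Z y} → Forest (suc k) (Z ++ [ y ]) → Forest (suc (suc k)) Z
Forest-init {k} f = go k f refl
  where
  go : ∀ k {ρ Z y} → Forest (suc k) ρ → ρ ≡ Z ++ [ y ] → Forest (suc (suc k)) Z
  go k {Z = Z} [] e with () ← ++-conicalʳ Z _ (sym e)
  go k {Z = Z} (_∷_ {X = X} {Y} d f) e with initLast Y
  ... | [] =
    Forest-≤ (s≤s (s≤s z≤n)) (proj₂ (Postorder-root (subst Postorder (trans (sym (++-identityʳ X)) e) d)))
  ... | Y′ ∷ʳ′ y′ with refl , refl ← ∷ʳ-injective (X ++ Y′) Z (trans (++-assoc X Y′ [ y′ ]) e) with k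
  ...   | zero with () ← ++-conicalʳ Y′ [ y′ ] (Forest-0 f)
  ...   | suc k′ = d ∷ go k′ f refl

Forest-split-pivot : ∀ {k Lg Sm y} → Forest (suc k) (Lg ++ Sm ++ [ y ]) → All (y <_) Lg → All (_< y) Sm →
  ∃[ a ] ∃[ c ] a + c ≤ k × Forest a Lg × Forest (suc (suc c)) Sm
Forest-split-pivot {k} {Lg} {Sm} {y} f y<Lg Sm<y
  with a , b , a+b≤ , fLg , fSmy ← Forest-split-above Lg f y<Lg (Allₚ.++⁺ (All.map <⇒≤ Sm<y) (≤-refl ∷ []))
  with b
... | zero  with () ← ++-conicalʳ Sm [ y ] (Forest-0 fSmy)
... | suc c = a , c , ≤-pred (subst (_≤ suc k) (+-suc a c) a+b≤) , fLg , Forest-init fSmy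

Forest-reassemble : ∀ {k a c y WS WL} → a + c ≤ k → Forest a WL → Forest (suc (suc c)) WS →
  All (_< y) WS → All (y <_) WL → Forest (suc k) (WS ++ WL ++ [ y ])
Forest-reassemble {a = a} {c} {WL = []} a+c≤k _ fWS WS<y _ =
  Forest-≤ (s≤s (≤-trans (m≤n+m c a) a+c≤k)) (Forest-root-last c fWS WS<y)
Forest-reassemble {k} {a} {c} {y} {WS} {WL@(_ ∷ _)} a+c≤k fWL fWS WS<y y<WL
  with a′ , B , Br , refl , WL≡ , dB , B≢[] , fBr ← Forest-first-block fWL (λ ())
  with A′ , C , WS≡ , fA′ , fC ← Forest-split c (subst (λ n → Forest n WS) (+-comm 2 c) fWS) =
  subst (Forest (suc k)) (sym shape)
    (Forest-≤ bound (Forest-++ fA′ (graft dB B≢[] fC C<y y<B ∷ Forest-++ fBr (Forest-1 (node [] [] [] [])))))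
  where
  open ≡-Reasoning
  C<y : All (_< y) C
  C<y = Allₚ.++⁻ʳ A′ (subst (All (_< y)) WS≡ WS<y)
  y<B : All (y <_) B
  y<B = Allₚ.++⁻ˡ B (subst (All (y <_)) WL≡ y<WL)
  blocks : ∀ a c → c + suc (a + 1) ≡ suc (suc a + c)
  blocks = solve-∀
  bound : c + suc (a′ + 1) ≤ suc k
  bound = subst (_≤ suc k) (sym (blocks a′ c)) (s≤s a+c≤k)
  shape : WS ++ WL ++ [ y ] ≡ A′ ++ (C ++ B) ++ Br ++ [ y ]
  shape = begin
    WS ++ WL ++ [ y ]                ≡⟨ cong₂ (λ P Q → P ++ Q ++ [ y ]) WS≡ WL≡ ⟩
    (A′ ++ C) ++ (B ++ Br) ++ [ y ]  ≡⟨ ++-assoc A′ C _ ⟩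
    A′ ++ C ++ (B ++ Br) ++ [ y ]    ≡⟨ cong (λ Z → A′ ++ C ++ Z) (++-assoc B Br [ y ]) ⟩
    A′ ++ C ++ B ++ Br ++ [ y ]      ≡⟨ cong (A′ ++_) (sym (++-assoc C B _)) ⟩
    A′ ++ (C ++ B) ++ Br ++ [ y ]    ∎

Avoids-⊆ : ∀ {σ τ} → σ ⊆ τ → Avoids τ p132 → Avoids σ p132
Avoids-⊆ σ⊆τ av (ρ , ρ⊆σ , std≡) = av (ρ , ⊆-trans ρ⊆σ σ⊆τ , std≡)

std-132 : ∀ {x b y} → x < y → y < b → std (x ∷ b ∷ y ∷ []) ≡ p132
std-132 {x} {b} {y} x<y y<b =
  cong₂ _∷_ (cong suc below-x) (cong₂ _∷_ (cong suc below-b) (cong₂ _∷_ (cong suc below-y) refl))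
  where
  x<b = <-trans x<y y<b
  below-x : count< x (x ∷ b ∷ y ∷ []) ≡ 0
  below-x rewrite filter-reject (_<? x) {x} {b ∷ y ∷ []} (<-irrefl refl)
                | filter-reject (_<? x) {b} {y ∷ []} (<⇒≯ x<b)
                | filter-reject (_<? x) {y} {[]} (<⇒≯ x<y) = refl
  below-b : count< b (x ∷ b ∷ y ∷ []) ≡ 2
  below-b rewrite filter-accept (_<? b) {x} {b ∷ y ∷ []} x<b
                | filter-reject (_<? b) {b} {y ∷ []} (<-irrefl refl)
                | filter-accept (_<? b) {y} {[]} y<b = refl
  below-y : count< y (x ∷ b ∷ y ∷ []) ≡ 1
  below-y rewrite filter-accept (_<? y) {x} {b ∷ y ∷ []} x<y
                | filter-reject (_<? y) {b} {y ∷ []} (<⇒≯ y<b)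
                | filter-reject (_<? y) {y} {[]} (<-irrefl refl) = refl

-- An entry x < y followed by an entry above y would form a 132 with y.
Avoids132-split : ∀ τ y → Avoids (τ ++ [ y ]) p132 → y ∉ τ →
  τ ≡ filter (∁? (_<? y)) τ ++ filter (_<? y) τ
Avoids132-split []      y _  _   = refl
Avoids132-split (x ∷ r) y av y∉ with x <? y
... | no x≮y rewrite filter-accept (∁? (_<? y)) {x} {r} x≮y | filter-reject (_<? y) {x} {r} x≮y =
  cong (x ∷_) (Avoids132-split r y (Avoids-⊆ (x ∷ʳ ⊆-refl) av) (y∉ ∘ there))
... | yes x<y rewrite filter-reject (∁? (_<? y)) {x} {r} (λ x≮y → x≮y x<y) | filter-accept (_<? y) {x} {r} x<y =
  sym (cong₂ _++_ (filter-none (∁? (_<? y)) (All.map (λ b<y b≮y → b≮y b<y) r<y))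
                                (cong (x ∷_) (filter-all (_<? y) r<y)))
  where
  r<y : All (_< y) r
  r<y = All.tabulate λ {b} b∈ → decidable-stable (b <? y) λ b≮y →
    av (x ∷ b ∷ y ∷ [] , refl ∷ Sub.++⁺ (from∈ b∈) ⊆-refl ,
        std-132 x<y (≤∧≢⇒< (≮⇒≥ b≮y) λ { refl → y∉ (there b∈) }))

pivots-forest : ∀ n τ → length τ ≤ n → Unique τ → Avoids τ p132 →
  ∀ {k} → Forest k τ → Forest k (pivots τ)
pivots-forest n τ len u av f with initLast τ
pivots-forest n       .[]          len u av     f | [] = f
pivots-forest zero    .(τ′ ++ [ y ]) len u av     f | τ′ ∷ʳ′ y
  with () ← subst (_≤ 0) (trans (length-++ τ′) (+-comm (length τ′) 1)) len
pivots-forest (suc n) .(τ′ ++ [ y ]) len u av {zero} f | τ′ ∷ʳ′ y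
  with () ← ++-conicalʳ τ′ [ y ] (Forest-0 f)
pivots-forest (suc n) .(τ′ ++ [ y ]) len u av {suc k} f | τ′ ∷ʳ′ y =
  subst (Forest (suc k)) (sym (pivots-snoc τ′ y))
    (reassemble (Forest-split-pivot (subst (Forest (suc k)) split f) y<Lg Sm<y))
  where
  Sm = filter (_<? y) τ′
  Lg = filter (∁? (_<? y)) τ′
  y∉τ′ : y ∉ τ′
  y∉τ′ = proj₁ (Unique-∷-middle τ′ u)
  split : τ′ ++ [ y ] ≡ Lg ++ Sm ++ [ y ]
  split = trans (cong (_++ [ y ]) (Avoids132-split τ′ y av y∉τ′)) (++-assoc Lg Sm [ y ])
  Sm<y : All (_< y) Sm
  Sm<y = Allₚ.all-filter (_<? y) τ′
  y<Lg : All (y <_) Lg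
  y<Lg = All.tabulate λ z∈ → let z∈τ′ , z≮y = ∈-filter⁻ (∁? (_<? y)) z∈ in
    ≤∧≢⇒< (≮⇒≥ z≮y) λ { refl → y∉τ′ z∈τ′ }
  τ′⊆ : τ′ ⊆ τ′ ++ [ y ]
  τ′⊆ = Sub.++⁺ʳ [ y ] ⊆-refl
  recurse : ∀ σ → σ ⊆ τ′ → ∀ {k} → Forest k σ → Forest k (pivots σ)
  recurse σ σ⊆τ′ = pivots-forest n σ
    (≤-trans (Sub.length-mono-≤ σ⊆τ′)
             (≤-pred (subst (_≤ suc n) (trans (length-++ τ′) (+-comm (length τ′) 1)) len)))
    (Unique-resp-⊆ (⊆-trans σ⊆τ′ τ′⊆) u) (Avoids-⊆ (⊆-trans σ⊆τ′ τ′⊆) av)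
  reassemble : ∃[ a ] ∃[ c ] a + c ≤ k × Forest a Lg × Forest (suc (suc c)) Sm →
    Forest (suc k) (pivots Sm ++ pivots Lg ++ [ y ])
  reassemble (a , c , a+c≤k , fLg , fSm) =
    Forest-reassemble a+c≤k (recurse Lg (Sub.filter-⊆ (∁? (_<? y)) τ′) fLg)
                            (recurse Sm (Sub.filter-⊆ (_<? y) τ′) fSm)
      (All-resp-↭ (↭-sym (pivots-↭ Sm)) Sm<y) (All-resp-↭ (↭-sym (pivots-↭ Lg)) y<Lg)

pivots-preserves : ∀ {π} → PostorderPerm π → Avoids π p132 → PostorderPerm (pivots π)
pivots-preserves {π} (d , u , pos) av =
  Forest-1⇒Postorder (pivots-forest (length π) π ≤-refl u av (Forest-1 d)) ,
  Unique-resp-↭ (↭-sym (pivots-↭ π)) u , All-resp-↭ (↭-sym (pivots-↭ π)) pos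

-- swlᵢ on S_n is a pivoting step

position-here : ∀ x xs → position x (x ∷ xs) ≡ 1
position-here x xs = if-does-yes (x ≟ x) refl

position-there : ∀ {v x} xs → v ≢ x → position v (x ∷ xs) ≡ suc (position v xs)
position-there {v} {x} xs v≢x = if-does-no (v ≟ x) v≢x

position-positive : ∀ {v} xs → v ∈ xs → 0 < position v xs
position-positive {v} (x ∷ xs) _ with v ≟ x
... | yes refl rewrite position-here x xs  = s≤s z≤n
... | no  v≢x  rewrite position-there xs v≢x = s≤s z≤n

position-≤-length : ∀ {v} xs → v ∈ xs → position v xs ≤ length xs
position-≤-length {v} (x ∷ xs) v∈ with v ≟ x | v∈
... | yes refl | _          rewrite position-here x xs  = s≤s z≤n
... | no  v≢x  | here v≡x   = ⊥-elim (v≢x v≡x)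
... | no  v≢x  | there v∈xs rewrite position-there xs v≢x = s≤s (position-≤-length xs v∈xs)

position-++ˡ : ∀ {v} X Y → v ∈ X → position v (X ++ Y) ≡ position v X
position-++ˡ {v} (x ∷ X) Y v∈ with v ≟ x | v∈
... | yes refl | _         rewrite position-here x (X ++ Y) | position-here x X = refl
... | no  v≢x  | here v≡x  = ⊥-elim (v≢x v≡x)
... | no  v≢x  | there v∈X rewrite position-there (X ++ Y) v≢x | position-there X v≢x =
  cong suc (position-++ˡ X Y v∈X)

position-++ʳ : ∀ {v} X Y → v ∉ X → position v (X ++ Y) ≡ length X + position v Y
position-++ʳ     []      Y v∉ = refl
position-++ʳ {v} (x ∷ X) Y v∉ rewrite position-there (X ++ Y) (v∉ ∘ here) =
  cong suc (position-++ʳ X Y (v∉ ∘ there))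

position-injective : ∀ {v w} xs → v ∈ xs → w ∈ xs → position v xs ≡ position w xs → v ≡ w
position-injective {v} {w} (x ∷ xs) v∈ w∈ e with v ≟ x | w ≟ x | v∈ | w∈
... | yes refl | yes refl | _          | _          = refl
... | no  v≢x  | _        | here v≡x   | _          = ⊥-elim (v≢x v≡x)
... | _        | no  w≢x  | _          | here w≡x   = ⊥-elim (w≢x w≡x)
... | yes refl | no  w≢x  | _          | there w∈xs
  rewrite position-here x xs | position-there xs w≢x = ⊥-elim (<-irrefl e (s≤s (position-positive xs w∈xs)))
... | no  v≢x  | yes refl | there v∈xs | _
  rewrite position-here x xs | position-there xs v≢x = ⊥-elim (<-irrefl (sym e) (s≤s (position-positive xs v∈xs)))
... | no  v≢x  | no  w≢x  | there v∈xs | there w∈xs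
  rewrite position-there xs v≢x | position-there xs w≢x = position-injective xs v∈xs w∈xs (suc-injective e)

-- 0-based lookup, with junk value 0 out of range
at : ℕ → List ℕ → ℕ
at _       []       = 0
at zero    (x ∷ _)  = x
at (suc k) (_ ∷ xs) = at k xs

at-applyUpTo : ∀ (f : ℕ → ℕ) {m k} → k < m → at k (applyUpTo f m) ≡ f k
at-applyUpTo f {suc m} {zero}  _        = refl
at-applyUpTo f {suc m} {suc k} (s≤s k<m) = at-applyUpTo (f ∘ suc) k<m

map-at-upTo : ∀ xs → map (λ k → at k xs) (upTo (length xs)) ≡ xs
map-at-upTo []       = refl
map-at-upTo (x ∷ xs) = cong (x ∷_) (begin
  map (λ k → at k (x ∷ xs)) (applyUpTo suc (length xs))   ≡⟨ cong (map _) (sym (map-upTo suc (length xs))) ⟩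
  map (λ k → at k (x ∷ xs)) (map suc (upTo (length xs)))  ≡⟨ sym (map-∘ (upTo (length xs))) ⟩
  map (λ k → at k xs) (upTo (length xs))                  ≡⟨ map-at-upTo xs ⟩
  xs                                                      ∎)
  where open ≡-Reasoning

at-∈ : ∀ {k} xs → k < length xs → at k xs ∈ xs
at-∈ {zero}  (x ∷ xs) _         = here refl
at-∈ {suc k} (x ∷ xs) (s≤s k<) = there (at-∈ xs k<)

position-at : ∀ {k} xs → Unique xs → k < length xs → position (at k xs) xs ≡ suc k
position-at {zero}  (x ∷ xs) _         _         = position-here x xs
position-at {suc k} (x ∷ xs) (x∉ ∷ u) (s≤s k<) =
  trans (position-there xs (λ { refl → All.lookup x∉ (at-∈ xs k<) refl })) (cong suc (position-at xs u k<))

module _ {n ρ} (ρ↭ : ρ ↭ range n) where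

  private
    σ = inverse n ρ
    |ρ| : length ρ ≡ n
    |ρ| = length-↭-range ρ↭
    uρ : Unique ρ
    uρ = Unique-resp-↭ (↭-sym ρ↭) (Unique-range n)
    uσ : Unique σ
    uσ = Unique-map⁺ (λ v → position v ρ)
           (λ v∈ w∈ → position-injective ρ (∈-resp-↭ (↭-sym ρ↭) v∈) (∈-resp-↭ (↭-sym ρ↭) w∈))
           (Unique-range n)
    |σ| : length σ ≡ n
    |σ| = trans (length-map _ (range n)) (length-range n)
    at-σ : ∀ {j} → j < n → at j σ ≡ position (suc j) ρ
    at-σ j< = trans (cong (at _) (trans (sym (map-∘ (upTo n))) (map-upTo _ n))) (at-applyUpTo _ j<)

  position-inverse : ∀ {k} → k < n → position (suc k) (inverse n ρ) ≡ at k ρ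
  position-inverse {k} k<n with j , u≡ , j<n ← range-∈ (∈-resp-↭ ρ↭ (at-∈ ρ (subst (k <_) (sym |ρ|) k<n))) =
    begin
      position (suc k) σ            ≡⟨ cong (λ v → position v σ) (sym at-j) ⟩
      position (at j σ) σ           ≡⟨ position-at σ uσ (subst (j <_) (sym |σ|) j<n) ⟩
      suc j                         ≡⟨ sym u≡ ⟩
      at k ρ                        ∎
    where
    open ≡-Reasoning
    at-j : at j σ ≡ suc k
    at-j = trans (at-σ j<n)
      (trans (cong (λ v → position v ρ) (sym u≡)) (position-at ρ uρ (subst (k <_) (sym |ρ|) k<n)))

  inverse-involutive : inverse n (inverse n ρ) ≡ ρ
  inverse-involutive = begin
    map (λ v → position v σ) (map suc (upTo n))  ≡⟨ sym (map-∘ (upTo n)) ⟩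
    map (λ k → position (suc k) σ) (upTo n)      ≡⟨ map-cong-local (All.map position-inverse (Allₚ.all-upTo n)) ⟩
    map (λ k → at k ρ) (upTo n)                  ≡⟨ cong (λ m → map (λ k → at k ρ) (upTo m)) (sym |ρ|) ⟩
    map (λ k → at k ρ) (upTo (length ρ))         ≡⟨ map-at-upTo ρ ⟩
    ρ                                            ∎
    where open ≡-Reasoning

module _ (K : ℕ → ℕ) where

  Increasing : List ℕ → Set
  Increasing = AllPairs (λ a b → K a < K b)

  position-rank : ∀ Z {v} → Increasing Z → v ∈ Z → position v Z ≡ suc (length (filter (λ w → K w <? K v) Z))
  position-rank (z ∷ Z) (Kz< ∷ _) (here refl)
    rewrite position-here z Z | filter-reject (λ w → K w <? K z) {z} {Z} (<-irrefl refl)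
          | filter-none (λ w → K w <? K z) (All.map (λ Kz<Kw Kw<Kz → <-asym Kz<Kw Kw<Kz) Kz<) = refl
  position-rank (z ∷ Z) {v} (Kz< ∷ inc) (there v∈)
    rewrite position-there {v} {z} Z (λ { refl → <-irrefl refl (All.lookup Kz< v∈) })
          | filter-accept (λ w → K w <? K v) {z} {Z} (All.lookup Kz< v∈) = cong suc (position-rank Z inc v∈)

  position-rank-above : ∀ Z {v} → Increasing Z → v ∈ Z →
    position v Z + length (filter (λ w → K v <? K w) Z) ≡ length Z
  position-rank-above (z ∷ Z) (Kz< ∷ _) (here refl)
    rewrite position-here z Z | filter-reject (λ w → K z <? K w) {z} {Z} (<-irrefl refl)
          | filter-all (λ w → K z <? K w) Kz< = refl
  position-rank-above (z ∷ Z) {v} (Kz< ∷ inc) (there v∈)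
    rewrite position-there {v} {z} Z (λ { refl → <-irrefl refl (All.lookup Kz< v∈) })
          | filter-reject (λ w → K v <? K w) {z} {Z} (<-asym (All.lookup Kz< v∈)) =
    cong suc (position-rank-above Z inc v∈)

⊆-increasing : ∀ {σ ρ} → σ ⊆ ρ → Unique ρ → Increasing (λ v → position v ρ) σ
⊆-increasing s u = AllPairs.map (proj₂ ∘ proj₂) (go s u)
  where
  Ordered : List ℕ → ℕ → ℕ → Set
  Ordered ρ a b = a ∈ ρ × b ∈ ρ × position a ρ < position b ρ
  shift : ∀ {y ρ a b} → y ∉ ρ → Ordered ρ a b → Ordered (y ∷ ρ) a b
  shift {y} {ρ} y∉ (a∈ , b∈ , a<b) =
    there a∈ , there b∈ ,
    subst₂ _<_ (sym (position-there ρ λ { refl → y∉ a∈ })) (sym (position-there ρ λ { refl → y∉ b∈ }))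
               (s≤s a<b)
  go : ∀ {σ ρ} → σ ⊆ ρ → Unique ρ → AllPairs (Ordered ρ) σ
  go []                 _          = []
  go (y ∷ʳ s)          (y∉ ∷ u) = AllPairs.map (shift (λ y∈ → All.lookup y∉ y∈ refl)) (go s u)
  go {ρ = x ∷ ρ} (refl ∷ s) (x∉ ∷ u) =
    All.tabulate (λ {b} b∈ → let b∈ρ = ⊆-lookup s b∈ in
      here refl , there b∈ρ ,
      subst₂ _<_ (sym (position-here x ρ)) (sym (position-there ρ λ { refl → All.lookup x∉ b∈ρ refl }))
             (s≤s (position-positive ρ b∈ρ))) ∷
    AllPairs.map (shift (λ x∈ → All.lookup x∉ x∈ refl)) (go s u)

filter-position-prefix : ∀ Pre c C → Unique (Pre ++ c ∷ C) →
  filter (λ w → position w (Pre ++ c ∷ C) <? suc (length Pre)) (Pre ++ c ∷ C) ≡ Pre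
filter-position-prefix Pre c C u =
  trans (filter-++ Q? Pre (c ∷ C))
    (trans (cong₂ _++_ (filter-all Q? in-Pre) (filter-none Q? after-Pre)) (++-identityʳ Pre))
  where
  ρ = Pre ++ c ∷ C
  Q? = λ w → position w ρ <? suc (length Pre)
  in-Pre : All (λ w → position w ρ < suc (length Pre)) Pre
  in-Pre = All.tabulate λ w∈ →
    s≤s (subst (_≤ length Pre) (sym (position-++ˡ Pre (c ∷ C) w∈)) (position-≤-length Pre w∈))
  after-Pre : All (λ w → ¬ position w ρ < suc (length Pre)) (c ∷ C)
  after-Pre = All.tabulate λ {w} w∈ → ≤⇒≯ (subst (suc (length Pre) ≤_)
    (sym (position-++ʳ {w} Pre (c ∷ C) (λ w∈Pre → Unique-++⁻-disjoint Pre u w∈Pre w∈)))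
    (subst (_≤ length Pre + position w (c ∷ C)) (+-comm (length Pre) 1)
           (+-monoʳ-≤ (length Pre) (position-positive (c ∷ C) w∈))))

rot-positions : ∀ n X → rot n X ≡ map (λ v → position v X) (reverse (range n))
rot-positions n X = sym (reverse-map (λ v → position v X) (range n))

-- rot lists the positions of n, n-1, …, 1; the entry i of rot ρ sits at the value c = ρᵢ, and
-- Lᵢ, Rᵢ are the positions before i of the entries of ρ above and below c.
module SwlPivot (n : ℕ) (Pre : List ℕ) (c : ℕ) (C : List ℕ) (ρ↭ : Pre ++ c ∷ C ↭ range n) where

  ρ = Pre ++ c ∷ C
  i = suc (length Pre)
  Sm = filter (_<? c) Pre
  Lg = filter (∁? (_<? c)) Pre
  ρ′ = Sm ++ Lg ++ c ∷ C
  Above = filter (c <?_) (reverse (range n))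
  Below = filter (_<? c) (reverse (range n))

  P : ℕ → ℕ
  P v = position v ρ

  P′ : ℕ → ℕ
  P′ v = position v ρ′

  L = filter (_<? i) (map P Above)
  R = filter (_<? i) (map P Below)

  uρ : Unique ρ
  uρ = Unique-resp-↭ (↭-sym ρ↭) (Unique-range n)

  c∉Pre : c ∉ Pre
  c∉Pre = proj₁ (Unique-∷-middle Pre uρ)

  rev-range↭ρ : reverse (range n) ↭ ρ
  rev-range↭ρ = ↭-trans (↭-reverse (range n)) (↭-sym ρ↭)

  |Sm|+|Lg| : length Sm + length Lg ≡ length Pre
  |Sm|+|Lg| = trans (sym (length-++ Sm)) (↭-length (filter-++-filter-∁-↭ (_<? c) Pre))

  Pre⊆ρ : Pre ⊆ ρ
  Pre⊆ρ = Sub.++⁺ʳ (c ∷ C) ⊆-refl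

  below-i : ∀ {Q : ℕ → Set} (Q? : Decidable Q) →
    filter (_<? i) (map P (filter Q? (reverse (range n)))) ↭ map P (filter Q? Pre)
  below-i Q? = ↭-trans (PermProps.filter-↭ (_<? i) (PermProps.map⁺ P (PermProps.filter-↭ Q? rev-range↭ρ)))
    (↭-reflexive (trans (filter-map (_<? i) P (filter Q? ρ))
      (cong (map P) (trans (filter-comm (λ w → P w <? i) Q? ρ)
                           (cong (filter Q?) (filter-position-prefix Pre c C uρ))))))

  filter-above-Pre : filter (c <?_) Pre ≡ Lg
  filter-above-Pre = filter-cong-local (c <?_) (∁? (_<? c)) (All.tabulate λ x∈ →
    (λ c<x → <⇒≯ c<x) , (λ x≮c → ≤∧≢⇒< (≮⇒≥ x≮c) λ { refl → c∉Pre x∈ }))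

  count>-L : ∀ q → count> q L ≡ length (filter (λ w → q <? P w) Lg)
  count>-L q =
    trans (↭-length (PermProps.filter-↭ (q <?_)
                       (↭-trans (below-i (c <?_)) (↭-reflexive (cong (map P) filter-above-Pre)))))
    (trans (cong length (filter-map (q <?_) P Lg)) (length-map P (filter (λ w → q <? P w) Lg)))

  count<-R : ∀ q → count< q R ≡ length (filter (λ w → P w <? q) Sm)
  count<-R q = trans (↭-length (PermProps.filter-↭ (_<? q) (below-i (_<? c))))
    (trans (cong length (filter-map (_<? q) P Sm)) (length-map P (filter (λ w → P w <? q) Sm)))

  P′-outside : ∀ {v} → v ∉ Pre → v ∈ c ∷ C → P′ v ≡ P v
  P′-outside {v} v∉ v∈ = begin
    position v (Sm ++ Lg ++ c ∷ C)               ≡⟨ position-++ʳ Sm _ (v∉ ∘ proj₁ ∘ ∈-filter⁻ (_<? c)) ⟩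
    length Sm + position v (Lg ++ c ∷ C)
      ≡⟨ cong (length Sm +_) (position-++ʳ Lg _ (v∉ ∘ proj₁ ∘ ∈-filter⁻ (∁? (_<? c)))) ⟩
    length Sm + (length Lg + position v (c ∷ C)) ≡⟨ sym (+-assoc (length Sm) (length Lg) _) ⟩
    length Sm + length Lg + position v (c ∷ C)   ≡⟨ cong (_+ position v (c ∷ C)) |Sm|+|Lg| ⟩
    length Pre + position v (c ∷ C)              ≡⟨ sym (position-++ʳ Pre (c ∷ C) v∉) ⟩
    P v                                          ∎
    where open ≡-Reasoning

  P-c : P c ≡ i
  P-c = trans (position-++ʳ Pre (c ∷ C) c∉Pre)
              (trans (cong (length Pre +_) (position-here c C)) (+-comm (length Pre) 1))

  i≤P : ∀ {v} → v ∉ Pre → v ∈ c ∷ C → i ≤ P v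
  i≤P {v} v∉ v∈ = subst (i ≤_) (sym (position-++ʳ Pre (c ∷ C) v∉))
    (subst (_≤ length Pre + position v (c ∷ C)) (+-comm (length Pre) 1)
           (+-monoʳ-≤ (length Pre) (position-positive (c ∷ C) v∈)))

  P<i : ∀ {v} → v ∈ Pre → P v < i
  P<i v∈ = s≤s (subst (_≤ length Pre) (sym (position-++ˡ Pre (c ∷ C) v∈)) (position-≤-length Pre v∈))

  P′-Lg : ∀ {v} → v ∈ Lg → P′ v ≡ swuˡ i L (P v)
  P′-Lg {v} v∈ = sym (begin
    swuˡ i L (P v)               ≡⟨ swuˡ-below i L (P<i v∈Pre) ⟩
    i ∸ suc (count> (P v) L)     ≡⟨ cong (λ z → i ∸ suc z) (count>-L (P v)) ⟩
    length Pre ∸ a               ≡⟨ cong (_∸ a) (trans (sym |Sm|+|Lg|) (cong (length Sm +_) (sym rank))) ⟩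
    length Sm + (pos + a) ∸ a    ≡⟨ cong (_∸ a) (sym (+-assoc (length Sm) pos a)) ⟩
    length Sm + pos + a ∸ a      ≡⟨ m+n∸n≡m (length Sm + pos) a ⟩
    length Sm + pos
      ≡⟨ sym (trans (position-++ʳ Sm _ v∉Sm) (cong (length Sm +_) (position-++ˡ Lg (c ∷ C) v∈))) ⟩
    P′ v                         ∎)
    where
    open ≡-Reasoning
    v∈Pre = proj₁ (∈-filter⁻ (∁? (_<? c)) v∈)
    v∉Sm : v ∉ Sm
    v∉Sm v∈Sm = proj₂ (∈-filter⁻ (∁? (_<? c)) {xs = Pre} v∈) (proj₂ (∈-filter⁻ (_<? c) {xs = Pre} v∈Sm))
    pos = position v Lg
    a = length (filter (λ w → P v <? P w) Lg)
    rank : pos + a ≡ length Lg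
    rank = position-rank-above P Lg (⊆-increasing (⊆-trans (Sub.filter-⊆ (∁? (_<? c)) Pre) Pre⊆ρ) uρ) v∈

  P′-Sm : ∀ {v} → v ∈ Sm → P′ v ≡ swuʳ i R (P v)
  P′-Sm {v} v∈ = begin
    P′ v                                         ≡⟨ position-++ˡ Sm (Lg ++ c ∷ C) v∈ ⟩
    position v Sm
      ≡⟨ position-rank P Sm (⊆-increasing (⊆-trans (Sub.filter-⊆ (_<? c) Pre) Pre⊆ρ) uρ) v∈ ⟩
    suc (length (filter (λ w → P w <? P v) Sm))  ≡⟨ cong suc (sym (count<-R (P v))) ⟩
    suc (count< (P v) R)                         ≡⟨ sym (swuʳ-below i R (P<i (proj₁ (∈-filter⁻ (_<? c) v∈)))) ⟩
    swuʳ i R (P v)                               ∎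
    where open ≡-Reasoning

  P′-Above : ∀ {v} → v ∈ Above → P′ v ≡ swuˡ i L (P v)
  P′-Above v∈ with v∈rr , c<v ← ∈-filter⁻ (c <?_) v∈ with ∈-++⁻ Pre (∈-resp-↭ rev-range↭ρ v∈rr)
  ... | inj₁ v∈Pre = P′-Lg (∈-filter⁺ (∁? (_<? c)) v∈Pre (<⇒≯ c<v))
  ... | inj₂ v∈cC  = trans (P′-outside v∉Pre v∈cC) (sym (swuˡ-fixed i L (i≤P v∉Pre v∈cC)))
    where v∉Pre = λ v∈Pre → Unique-++⁻-disjoint Pre uρ v∈Pre v∈cC

  P′-Below : ∀ {v} → v ∈ Below → P′ v ≡ swuʳ i R (P v)
  P′-Below v∈ with v∈rr , v<c ← ∈-filter⁻ (_<? c) v∈ with ∈-++⁻ Pre (∈-resp-↭ rev-range↭ρ v∈rr)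
  ... | inj₁ v∈Pre = P′-Sm (∈-filter⁺ (_<? c) v∈Pre v<c)
  ... | inj₂ v∈cC  = trans (P′-outside v∉Pre v∈cC) (sym (swuʳ-fixed i R (i≤P v∉Pre v∈cC)))
    where v∉Pre = λ v∈Pre → Unique-++⁻-disjoint Pre uρ v∈Pre v∈cC

  reverse-range-split : reverse (range n) ≡ Above ++ c ∷ Below
  reverse-range-split = descending-split (reverse-range-descending n)
    (∈-resp-↭ (↭-sym rev-range↭ρ) (∈-++⁺ʳ Pre (here refl)))

  rot-ρ : rot n ρ ≡ map P Above ++ i ∷ map P Below
  rot-ρ = trans (rot-positions n ρ) (trans (cong (map P) reverse-range-split)
    (trans (map-++ P Above (c ∷ Below)) (cong (λ j → map P Above ++ j ∷ map P Below) P-c)))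

  i∉P[Above] : All (λ j → ¬ i ≡ j) (map P Above)
  i∉P[Above] = Allₚ.map⁺ (All.tabulate λ v∈ i≡Pv → let v∈rr , c<v = ∈-filter⁻ (c <?_) v∈ in
    <-irrefl (position-injective ρ (∈-++⁺ʳ Pre (here refl)) (∈-resp-↭ rev-range↭ρ v∈rr) (trans P-c i≡Pv)) c<v)

  rot-pivot : rot n ρ′ ≡ swuᵢ i (rot n ρ)
  rot-pivot = begin
    rot n ρ′
      ≡⟨ trans (rot-positions n ρ′) (trans (cong (map P′) reverse-range-split) (map-++ P′ Above (c ∷ Below))) ⟩
    map P′ Above ++ P′ c ∷ map P′ Below
      ≡⟨ cong₂ (λ X Y → X ++ Y) (trans (map-cong-local (All.tabulate P′-Above)) (map-∘ Above))
               (cong₂ _∷_ (trans (P′-outside c∉Pre (here refl)) P-c)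
                          (trans (map-cong-local (All.tabulate P′-Below)) (map-∘ Below))) ⟩
    map (swuˡ i L) (map P Above) ++ i ∷ map (swuʳ i R) (map P Below)
      ≡⟨ sym (swuᵢ-break i (map P Above ++ i ∷ map P Below)
                         (break-first (i ≟_) (map P Above) (map P Below) i∉P[Above] refl)) ⟩
    swuᵢ i (map P Above ++ i ∷ map P Below)
      ≡⟨ cong (swuᵢ i) (sym rot-ρ) ⟩
    swuᵢ i (rot n ρ)
      ∎
    where open ≡-Reasoning

  swlᵢ-pivotPrefix : swlᵢ n i ρ ≡ pivotPrefix Pre (c ∷ C)
  swlᵢ-pivotPrefix = begin
    rot⁻¹ n (swuᵢ i (rot n ρ))             ≡⟨ cong (rot⁻¹ n) (sym rot-pivot) ⟩
    inverse n (reverse (rot n ρ′))         ≡⟨ cong (inverse n) (reverse-involutive (inverse n ρ′)) ⟩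
    inverse n (inverse n ρ′)               ≡⟨ inverse-involutive (↭-trans (pivotPrefix-↭ Pre (c ∷ C)) ρ↭) ⟩
    ρ′                                     ∎
    where open ≡-Reasoning

swlᵢ-pivot : ∀ n k ρ → ρ ↭ range n → k < n → swlᵢ n (suc k) ρ ≡ pivot (suc k) ρ
swlᵢ-pivot n k ρ ρ↭ k<n
  with Pre , c , C , refl , refl ← split-at k ρ (subst (k <_) (sym (length-↭-range ρ↭)) k<n) =
  trans (SwlPivot.swlᵢ-pivotPrefix n Pre c C ρ↭) (sym (pivot-at Pre c C))

composeDown-preserves : ∀ {I : List ℕ → Set} (f : ℕ → List ℕ → List ℕ) → (∀ i π → I π → I (f i π)) →
  ∀ n π → I π → I (composeDown n f π)
composeDown-preserves {I} f pres n π Iπ = go (range n)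
  where
  go : ∀ js → I (foldr f π js)
  go []       = Iπ
  go (j ∷ js) = pres j _ (go js)

swl-pivots : ∀ n π → π ↭ range n → swl n π ≡ pivots π
swl-pivots n π π↭ = trans (go (range n) (range-bounds n))
  (cong (foldr pivot π ∘ range) (sym (length-↭-range π↭)))
  where
  go : ∀ js → All (λ j → 0 < j × j ≤ n) js → foldr (swlᵢ n) π js ≡ foldr pivot π js
  go []           []               = refl
  go (suc k ∷ js) ((_ , k<n) ∷ js≤) =
    trans (cong (swlᵢ n (suc k)) (go js js≤)) (swlᵢ-pivot n k _ (↭-trans (foldr-pivot-↭ js π) π↭) k<n)

lemma4p5 : (n : ℕ) (π : List ℕ) → IsPermOf n π → Sorted π →
    (Sorted (swu n π) × Sorted (swd n π)) × (Avoids π p132 → Sorted (swl n π))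
lemma4p5 n π π↭ sorted =
  (PostorderPerm⇒Sorted (composeDown-preserves swuᵢ swuᵢ-preserves n π p) ,
   PostorderPerm⇒Sorted (composeDown-preserves swdᵢ swdᵢ-preserves n π p)) ,
  λ av → subst Sorted (sym (swl-pivots n π π↭)) (PostorderPerm⇒Sorted (pivots-preserves p av))
  where
  p = Sorted⇒PostorderPerm sorted
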